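{- Let $\perp$ be the polarity of $\mathbb{F}_q^n$ associated with either a non-degenerate Hermitian form ($q$ a square) or a non-degenerate quadratic form with $q$ odd, so that the associated polar space is one of $O^+(2d,q)$, $U(2d,\sqrt q)$, $U(2d+1,\sqrt q)$, $O(2d+1,q)$, $O^-(2d+2,q)$, of rank $d\ge 3$. Let $\Gamma$ be the polarity graph. Let $3\le m\le d$ and let $L_1,L_2$ be $(m-1)$-dimensional subspaces which are not totally isotropic, such that $L_1\cap L_2$ has dimension $m-2$ and equals the radical of $L_1$ and the radical of $L_2$, i.e. $L_1\cap L_2=L_1\cap L_1^\perp=L_2\cap L_2^\perp$. Let $C_1$ be the set of non-isotropic points of $L_1$ not contained in $L_2$, and $C_2$ the set of non-isotropic points of $L_2$ not contained in $L_1$. Then $\{C_1,C_2\}$ is a switching set of $\Gamma$.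
   Context: Points are $1$-dimensional subspaces of $\mathbb{F}_q^n$; a point $x$ is isotropic if $x\subseteq x^\perp$. The polarity graph $\Gamma$ has the non-isotropic points as vertices, two points $x,y$ adjacent iff $x\subseteq y^\perp$. The rank is the dimension of a maximal totally isotropic subspace. For a vertex $x$, $\Gamma(x)$ is its neighbourhood. For disjoint vertex sets $C_1,C_2$ with $D$ the remaining vertices: $\{C_1,C_2\}$ is a switching set if $|C_1|=|C_2|$, the induced subgraphs on $C_1$, $C_2$, $C_1\cup C_2$ are regular with equal degrees on $C_1$ and $C_2$, and every $x\in D$ satisfies $|\Gamma(x)\cap C_1|=|\Gamma(x)\cap C_2|$ or $\Gamma(x)\cap(C_1\cup C_2)\in\{C_1,C_2\}$. -}

module Defs where

open import Level using (0ℓ)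
open import Data.Nat using (ℕ; zero; suc; _∸_; _≤_)
open import Data.Nat.Divisibility using (_∣_)
open import Data.Fin using (Fin)
open import Data.Vec using (Vec; []; _∷_; lookup; zipWith; map; replicate; foldr)
open import Data.List using (List; length)
open import Data.List.Membership.Propositional using (_∈_)
open import Data.List.Relation.Unary.Unique.Propositional using (Unique)
open import Data.Product using (Σ; ∃; ∃-syntax; _×_; _,_)
open import Data.Sum using (_⊎_)
open import Data.Empty using (⊥)
open import Relation.Nullary using (¬_)
open import Relation.Binary.PropositionalEquality using (_≡_)
open import Function.Bundles using (_⇔_)
open import Algebra.Structures using (IsCommutativeRing)

-- Finite fields of order q, realised on the carrier Fin q with
-- propositional equality (every finite field of order q is isomorphic
-- to such a structure).

record FiniteField (q : ℕ) : Set where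
  field
    _+_ _*_ : Fin q → Fin q → Fin q
    -_      : Fin q → Fin q
    0# 1#   : Fin q
    isCommutativeRing : IsCommutativeRing _≡_ _+_ _*_ -_ 0# 1#
    0≢1     : ¬ (0# ≡ 1#)
    inverse : ∀ a → ¬ (a ≡ 0#) → ∃[ b ] (a * b ≡ 1#)

  infixl 6 _+_ _-_
  infixl 7 _*_

  _-_ : Fin q → Fin q → Fin q
  a - b = a + (- b)

_HasSize_ : {A : Set} → (A → Set) → ℕ → Set
_HasSize_ {A} S k =
  Σ (List A) λ xs → length xs ≡ k × Unique xs × (∀ a → S a ⇔ (a ∈ xs))

module Geometry {q : ℕ} (F : FiniteField q) (n : ℕ) where
  open FiniteField F

  K : Set
  K = Fin q

  V : Set
  V = Vec K n

  zeroV : V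
  zeroV = replicate n 0#

  _+V_ : V → V → V
  u +V v = zipWith _+_ u v

  _·V_ : K → V → V
  a ·V v = map (a *_) v

  ∑ : {k : ℕ} → (Fin k → K) → K
  ∑ {k} f = foldr (λ _ → K) _+_ 0# (Data.Vec.tabulate f)

  Subspace : Set₁
  Subspace = V → Set

  IsSubspace : Subspace → Set
  IsSubspace W = W zeroV × (∀ u v → W u → W v → W (u +V v))
                        × (∀ a v → W v → W (a ·V v))

  linComb : {k : ℕ} → Vec K k → Vec V k → V
  linComb []       []       = zeroV
  linComb (c ∷ cs) (v ∷ vs) = (c ·V v) +V linComb cs vs

  Span : {k : ℕ} → Vec V k → Subspace
  Span {k} vs v = ∃[ cs ] (linComb {k} cs vs ≡ v)

  LinearlyIndependent : {k : ℕ} → Vec V k → Set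
  LinearlyIndependent {k} vs =
    ∀ (cs : Vec K k) → linComb cs vs ≡ zeroV → cs ≡ replicate k 0#

  HasDim : Subspace → ℕ → Set
  HasDim W k = Σ (Vec V k) λ vs →
    LinearlyIndependent vs × (∀ v → W v ⇔ Span vs v)

  _∩_ : Subspace → Subspace → Subspace
  (W ∩ U) v = W v × U v

  SameSet : {A : Set} → (A → Set) → (A → Set) → Set
  SameSet {A} P Q = ∀ a → P a ⇔ Q a

  -- Points: 1-dimensional subspaces, represented by their unique
  -- normalised spanning vector (first non-zero coordinate equal to 1).

  Normalised : {k : ℕ} → Vec K k → Set
  Normalised []       = ⊥
  Normalised (x ∷ xs) = (x ≡ 0# × Normalised xs) ⊎ (x ≡ 1#)

  Point : V → Set
  Point = Normalised

  record IsInvolutoryAutomorphism (σ : K → K) : Set where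
    field
      σ-+   : ∀ a b → σ (a + b) ≡ σ a + σ b
      σ-*   : ∀ a b → σ (a * b) ≡ σ a * σ b
      σ-inv : ∀ a → σ (σ a) ≡ a
      σ-nontrivial : ∃[ a ] ¬ (σ a ≡ a)

  hermitian : (K → K) → (Fin n → Fin n → K) → V → V → K
  hermitian σ H x y = ∑ λ i → ∑ λ j → lookup x i * H i j * σ (lookup y j)

  NonDegenerate : (V → V → K) → Set
  NonDegenerate f = ∀ x → (∀ y → f x y ≡ 0#) → x ≡ zeroV

  quadratic : (Fin n → Fin n → K) → V → K
  quadratic A x = ∑ λ i → ∑ λ j → A i j * lookup x i * lookup x j

  polarForm : (Fin n → Fin n → K) → V → V → K
  polarForm A x y = quadratic A (x +V y) - quadratic A x - quadratic A y

  data PolarityForm : (V → V → K) → Set where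
    herm : (σ : K → K) → IsInvolutoryAutomorphism σ →
           (H : Fin n → Fin n → K) → (∀ i j → H j i ≡ σ (H i j)) →
           NonDegenerate (hermitian σ H) → PolarityForm (hermitian σ H)
    quad : (A : Fin n → Fin n → K) → ¬ (2 ∣ q) →
           NonDegenerate (polarForm A) → PolarityForm (polarForm A)

  module _ (f : V → V → K) where

    Orth : V → V → Set
    Orth x y = f x y ≡ 0#

    perp : Subspace → Subspace
    perp W y = ∀ x → W x → Orth x y

    Isotropic : V → Set
    Isotropic x = Orth x x

    TotallyIsotropic : Subspace → Set
    TotallyIsotropic W = ∀ x y → W x → W y → Orth x y

    HasRank : ℕ → Set₁
    HasRank d =
      (∃[ W ] (IsSubspace W × TotallyIsotropic W × HasDim W d)) ×
      (∀ W k → IsSubspace W → TotallyIsotropic W → HasDim W k → k ≤ d)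

    Vertex : V → Set
    Vertex x = Point x × ¬ Isotropic x

    Adj : V → V → Set
    Adj x y = Orth y x

    nbhdIn : V → (V → Set) → V → Set
    nbhdIn x S y = Adj x y × S y

    _∪_ : (V → Set) → (V → Set) → V → Set
    (S ∪ T) v = S v ⊎ T v

    RegularOfDegree : (V → Set) → ℕ → Set
    RegularOfDegree S r = ∀ x → S x → nbhdIn x S HasSize r

    IsSwitchingSet : (V → Set) → (V → Set) → Set
    IsSwitchingSet C₁ C₂ =
      (∀ x → C₁ x → Vertex x) × (∀ x → C₂ x → Vertex x) ×
      (∀ x → C₁ x → C₂ x → ⊥) ×
      (∃[ k ] (C₁ HasSize k × C₂ HasSize k)) ×
      (∃[ r ] (RegularOfDegree C₁ r × RegularOfDegree C₂ r)) ×
      (∃[ s ] RegularOfDegree (C₁ ∪ C₂) s) ×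
      (∀ x → Vertex x → ¬ C₁ x → ¬ C₂ x →
         (∃[ k ] (nbhdIn x C₁ HasSize k × nbhdIn x C₂ HasSize k))
         ⊎ SameSet (nbhdIn x (C₁ ∪ C₂)) C₁
         ⊎ SameSet (nbhdIn x (C₁ ∪ C₂)) C₂)

-- Let R = L₁ ∩ L₂ be the common radical, so that L₁ = R ⊕ ⟨v⟩ and L₂ = R ⊕ ⟨w⟩ with v, w
-- non-isotropic. For y = r + a v in L₁ ∖ L₂ we have a ≠ 0 and f(y, x) = f(r, x) + a f(v, x); hence
-- C₁ and C₂ are cocliques, and a point of C₁ is adjacent to a point of C₂ exactly when v ⊥ w.
-- For every t ∈ R, the map r + a v ↦ (r + a t) + a w induces a bijection C₁ → C₂ on points, and
-- it preserves adjacency to x whenever x ⊥ w − v + t. Such a t exists unless x ⊥ R and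
-- f(v, x) ≠ f(w, x), and then x is adjacent to all of C₁, all of C₂, or to neither.

module Submission where

open import Defs
open import Data.Nat using (ℕ; zero; suc; _<_; _≤_; _∸_; s≤s)
open import Data.Fin using (Fin) renaming (zero to fzero; suc to fsuc)
open import Data.Vec using (Vec; []; _∷_; lookup; zipWith; map; replicate; foldr; tabulate; head; tail)
open import Data.Product using (Σ; ∃-syntax; _×_; _,_; proj₁; proj₂)
open import Data.Sum using (_⊎_; inj₁; inj₂)
open import Data.Empty using (⊥; ⊥-elim)
open import Function using (id; _∘_)
open import Function.Bundles using (_⇔_; mk⇔; Equivalence)
open import Relation.Nullary using (¬_; Dec; yes; no; ¬?)
open import Relation.Unary using (Decidable)
open import Relation.Binary.PropositionalEquality
open import Algebra.Bundles using (CommutativeRing)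

module FieldProperties {q : ℕ} (F : FiniteField q) where
  import Data.Fin as Fin

  open FiniteField F public

  commutativeRing : CommutativeRing _ _
  commutativeRing = record { isCommutativeRing = isCommutativeRing }

  open CommutativeRing commutativeRing public
    using (+-assoc; +-comm; +-identityˡ; +-identityʳ; -‿inverseˡ; -‿inverseʳ;
           *-assoc; *-comm; *-identityˡ; *-identityʳ; distribˡ; distribʳ; zeroˡ; zeroʳ)
  open import Algebra.Properties.Ring (CommutativeRing.ring commutativeRing) public
    using (-1*x≈-x; x+x≈x⇒x≈0; +-inverseʳ-unique)
  open import Algebra.Solver.Ring.NaturalCoefficients.Default
    (CommutativeRing.commutativeSemiring commutativeRing) using (solve; _:+_; _:*_; _:=_; con)

  K : Set
  K = Fin q

  _≟_ : (a b : K) → Dec (a ≡ b)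
  _≟_ = Fin._≟_

  -- 0 ⁻¹ is the junk value 0.
  _⁻¹ : K → K
  a ⁻¹ with a ≟ 0#
  ... | yes _ = 0#
  ... | no a≢0 = proj₁ (inverse a a≢0)

  ⁻¹-inverseʳ : ∀ {a} → a ≢ 0# → a * a ⁻¹ ≡ 1#
  ⁻¹-inverseʳ {a} a≢0 with a ≟ 0#
  ... | yes a≡0 = ⊥-elim (a≢0 a≡0)
  ... | no a≢0′ = proj₂ (inverse a a≢0′)

  ⁻¹-inverseˡ : ∀ {a} → a ≢ 0# → a ⁻¹ * a ≡ 1#
  ⁻¹-inverseˡ {a} a≢0 = trans (*-comm (a ⁻¹) a) (⁻¹-inverseʳ a≢0)

  *-cancelˡ-≡0 : ∀ {a} x → a ≢ 0# → a * x ≡ 0# → x ≡ 0#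
  *-cancelˡ-≡0 {a} x a≢0 ax≡0 = begin
    x               ≡⟨ sym (*-identityˡ x) ⟩
    1# * x          ≡⟨ cong (_* x) (sym (⁻¹-inverseˡ a≢0)) ⟩
    (a ⁻¹ * a) * x  ≡⟨ *-assoc (a ⁻¹) a x ⟩
    a ⁻¹ * (a * x)  ≡⟨ cong (a ⁻¹ *_) ax≡0 ⟩
    a ⁻¹ * 0#       ≡⟨ zeroʳ (a ⁻¹) ⟩
    0#              ∎
    where open ≡-Reasoning

  *-≢0 : ∀ {a b} → a ≢ 0# → b ≢ 0# → a * b ≢ 0#
  *-≢0 {b = b} a≢0 b≢0 ab≡0 = b≢0 (*-cancelˡ-≡0 b a≢0 ab≡0)

  ⁻¹-≢0 : ∀ {a} → a ≢ 0# → a ⁻¹ ≢ 0#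
  ⁻¹-≢0 {a} a≢0 a⁻¹≡0 =
    0≢1 (trans (sym (zeroʳ a)) (trans (cong (a *_) (sym a⁻¹≡0)) (⁻¹-inverseʳ a≢0)))

  x+-x≡0 : ∀ x → x + (- 1#) * x ≡ 0#
  x+-x≡0 x = trans (cong (x +_) (-1*x≈-x x)) (-‿inverseʳ x)

  ∑ : {k : ℕ} → (Fin k → K) → K
  ∑ f = foldr (λ _ → K) _+_ 0# (tabulate f)

  ∑-cong : ∀ {k} {f g : Fin k → K} → (∀ i → f i ≡ g i) → ∑ f ≡ ∑ g
  ∑-cong {zero}  f≗g = refl
  ∑-cong {suc k} f≗g = cong₂ _+_ (f≗g fzero) (∑-cong (λ i → f≗g (fsuc i)))

  ∑-distrib-+ : ∀ {k} (f g : Fin k → K) → ∑ (λ i → f i + g i) ≡ ∑ f + ∑ g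
  ∑-distrib-+ {zero}  f g = sym (+-identityʳ 0#)
  ∑-distrib-+ {suc k} f g = begin
    (f₀ + g₀) + ∑ (λ i → f (fsuc i) + g (fsuc i))
      ≡⟨ cong ((f₀ + g₀) +_) (∑-distrib-+ (λ i → f (fsuc i)) (λ i → g (fsuc i))) ⟩
    (f₀ + g₀) + (∑ (λ i → f (fsuc i)) + ∑ (λ i → g (fsuc i)))
      ≡⟨ solve 4 (λ a b c d → (a :+ b) :+ (c :+ d) := (a :+ c) :+ (b :+ d)) refl
           f₀ g₀ (∑ (λ i → f (fsuc i))) (∑ (λ i → g (fsuc i))) ⟩
    (f₀ + ∑ (λ i → f (fsuc i))) + (g₀ + ∑ (λ i → g (fsuc i))) ∎
    where
    open ≡-Reasoning
    f₀ = f fzero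
    g₀ = g fzero

  *-distribˡ-∑ : ∀ {k} (c : K) (f : Fin k → K) → ∑ (λ i → c * f i) ≡ c * ∑ f
  *-distribˡ-∑ {zero}  c f = sym (zeroʳ c)
  *-distribˡ-∑ {suc k} c f =
    trans (cong (c * f fzero +_) (*-distribˡ-∑ c (λ i → f (fsuc i)))) (sym (distribˡ c (f fzero) _))

  ∑-zero : ∀ {k} → ∑ {k} (λ _ → 0#) ≡ 0#
  ∑-zero {zero}  = refl
  ∑-zero {suc k} = trans (cong (0# +_) (∑-zero {k})) (+-identityʳ 0#)

  ∑-comm : ∀ {k l} (g : Fin k → Fin l → K) →
           ∑ (λ i → ∑ (λ j → g i j)) ≡ ∑ (λ j → ∑ (λ i → g i j))
  ∑-comm {zero}  {l} g = sym (∑-zero {l})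
  ∑-comm {suc k} {l} g = begin
    ∑ (λ j → g fzero j) + ∑ (λ i → ∑ (λ j → g (fsuc i) j))
      ≡⟨ cong (∑ (λ j → g fzero j) +_) (∑-comm (λ i j → g (fsuc i) j)) ⟩
    ∑ (λ j → g fzero j) + ∑ (λ j → ∑ (λ i → g (fsuc i) j))
      ≡⟨ sym (∑-distrib-+ (λ j → g fzero j) (λ j → ∑ (λ i → g (fsuc i) j))) ⟩
    ∑ (λ j → g fzero j + ∑ (λ i → g (fsuc i) j)) ∎
    where open ≡-Reasoning

  ∑-homo : (σ : K → K) → (∀ a b → σ (a + b) ≡ σ a + σ b) → σ 0# ≡ 0# →
           ∀ {k} (f : Fin k → K) → σ (∑ f) ≡ ∑ (λ i → σ (f i))
  ∑-homo σ σ-+ σ-0 {zero}  f = σ-0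
  ∑-homo σ σ-+ σ-0 {suc k} f =
    trans (σ-+ (f fzero) _) (cong (σ (f fzero) +_) (∑-homo σ σ-+ σ-0 (λ i → f (fsuc i))))

module CoordinateSpace {q : ℕ} (F : FiniteField q) where
  open FieldProperties F public

  infixl 6 _⊕_ _⊖_
  infixr 7 _⊙_

  _⊕_ : ∀ {k} → Vec K k → Vec K k → Vec K k
  _⊕_ = zipWith _+_

  _⊙_ : ∀ {k} → K → Vec K k → Vec K k
  a ⊙ u = map (a *_) u

  _⊖_ : ∀ {k} → Vec K k → Vec K k → Vec K k
  u ⊖ w = u ⊕ (- 1#) ⊙ w

  𝟘 : ∀ k → Vec K k
  𝟘 k = replicate k 0#

  ⊕-comm : ∀ {k} (u w : Vec K k) → u ⊕ w ≡ w ⊕ u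
  ⊕-comm []      []      = refl
  ⊕-comm (x ∷ u) (y ∷ w) = cong₂ _∷_ (+-comm x y) (⊕-comm u w)

  ⊕-assoc : ∀ {k} (u v w : Vec K k) → (u ⊕ v) ⊕ w ≡ u ⊕ (v ⊕ w)
  ⊕-assoc []      []      []      = refl
  ⊕-assoc (x ∷ u) (y ∷ v) (z ∷ w) = cong₂ _∷_ (+-assoc x y z) (⊕-assoc u v w)

  ⊕-identityʳ : ∀ {k} (u : Vec K k) → u ⊕ 𝟘 k ≡ u
  ⊕-identityʳ []      = refl
  ⊕-identityʳ (x ∷ u) = cong₂ _∷_ (+-identityʳ x) (⊕-identityʳ u)

  ⊕-identityˡ : ∀ {k} (u : Vec K k) → 𝟘 k ⊕ u ≡ u
  ⊕-identityˡ []      = refl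
  ⊕-identityˡ (x ∷ u) = cong₂ _∷_ (+-identityˡ x) (⊕-identityˡ u)

  ⊕-inverseʳ : ∀ {k} (u : Vec K k) → u ⊖ u ≡ 𝟘 k
  ⊕-inverseʳ []      = refl
  ⊕-inverseʳ (x ∷ u) = cong₂ _∷_ (x+-x≡0 x) (⊕-inverseʳ u)

  ⊕-inverseʳ-unique : ∀ {k} (u w : Vec K k) → u ⊕ w ≡ 𝟘 k → w ≡ (- 1#) ⊙ u
  ⊕-inverseʳ-unique []      []      _ = refl
  ⊕-inverseʳ-unique (x ∷ u) (y ∷ w) e = cong₂ _∷_
    (trans (+-inverseʳ-unique x y (cong head e)) (sym (-1*x≈-x x)))
    (⊕-inverseʳ-unique u w (cong tail e))

  ⊖-anticomm : ∀ {k} (u w : Vec K k) → (u ⊖ w) ⊕ (w ⊖ u) ≡ 𝟘 k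
  ⊖-anticomm []      []      = refl
  ⊖-anticomm (x ∷ u) (y ∷ w) = cong₂ _∷_ (begin
    (x + - 1# * y) + (y + - 1# * x)  ≡⟨ cong₂ (λ s t → (x + s) + (y + t)) (-1*x≈-x y) (-1*x≈-x x) ⟩
    (x + - y) + (y + - x)            ≡⟨ +-assoc x (- y) _ ⟩
    x + (- y + (y + - x))            ≡⟨ cong (x +_) (sym (+-assoc (- y) y (- x))) ⟩
    x + ((- y + y) + - x)            ≡⟨ cong (λ s → x + (s + - x)) (-‿inverseˡ y) ⟩
    x + (0# + - x)                   ≡⟨ cong (x +_) (+-identityˡ (- x)) ⟩
    x + - x                          ≡⟨ -‿inverseʳ x ⟩
    0#                               ∎) (⊖-anticomm u w)
    where open ≡-Reasoning

  x⊕yz≡y⊕xz : ∀ {k} (u v w : Vec K k) → u ⊕ (v ⊕ w) ≡ v ⊕ (u ⊕ w)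
  x⊕yz≡y⊕xz u v w =
    trans (sym (⊕-assoc u v w)) (trans (cong (_⊕ w) (⊕-comm u v)) (⊕-assoc v u w))

  xy⊕zw≡xz⊕yw : ∀ {k} (s u v w : Vec K k) → (s ⊕ u) ⊕ (v ⊕ w) ≡ (s ⊕ v) ⊕ (u ⊕ w)
  xy⊕zw≡xz⊕yw s u v w =
    trans (⊕-assoc s u (v ⊕ w)) (trans (cong (s ⊕_) (x⊕yz≡y⊕xz u v w)) (sym (⊕-assoc s v (u ⊕ w))))

  ⊙-distribˡ : ∀ {k} a (u w : Vec K k) → a ⊙ (u ⊕ w) ≡ a ⊙ u ⊕ a ⊙ w
  ⊙-distribˡ a []      []      = refl
  ⊙-distribˡ a (x ∷ u) (y ∷ w) = cong₂ _∷_ (distribˡ a x y) (⊙-distribˡ a u w)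

  ⊙-distribʳ : ∀ {k} a b (u : Vec K k) → (a + b) ⊙ u ≡ a ⊙ u ⊕ b ⊙ u
  ⊙-distribʳ a b []      = refl
  ⊙-distribʳ a b (x ∷ u) = cong₂ _∷_ (distribʳ x a b) (⊙-distribʳ a b u)

  ⊙-assoc : ∀ {k} a b (u : Vec K k) → (a * b) ⊙ u ≡ a ⊙ (b ⊙ u)
  ⊙-assoc a b []      = refl
  ⊙-assoc a b (x ∷ u) = cong₂ _∷_ (*-assoc a b x) (⊙-assoc a b u)

  ⊙-identity : ∀ {k} (u : Vec K k) → 1# ⊙ u ≡ u
  ⊙-identity []      = refl
  ⊙-identity (x ∷ u) = cong₂ _∷_ (*-identityˡ x) (⊙-identity u)

  ⊙-zeroˡ : ∀ {k} (u : Vec K k) → 0# ⊙ u ≡ 𝟘 k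
  ⊙-zeroˡ []      = refl
  ⊙-zeroˡ (x ∷ u) = cong₂ _∷_ (zeroˡ x) (⊙-zeroˡ u)

  ⊙-zeroʳ : ∀ {k} a → a ⊙ 𝟘 k ≡ 𝟘 k
  ⊙-zeroʳ {zero}  a = refl
  ⊙-zeroʳ {suc k} a = cong₂ _∷_ (zeroʳ a) (⊙-zeroʳ a)

  ⊙-cancelˡ : ∀ {k} {a} (u : Vec K k) → a ≢ 0# → a ⁻¹ ⊙ (a ⊙ u) ≡ u
  ⊙-cancelˡ {a = a} u a≢0 =
    trans (sym (⊙-assoc (a ⁻¹) a u)) (trans (cong (_⊙ u) (⁻¹-inverseˡ a≢0)) (⊙-identity u))

  lc : ∀ {k l} → Vec K l → Vec (Vec K k) l → Vec K k
  lc {k} = Geometry.linComb F k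

  lc-⊕ : ∀ {k l} (a b : Vec K l) (es : Vec (Vec K k) l) → lc (a ⊕ b) es ≡ lc a es ⊕ lc b es
  lc-⊕ []      []      []       = sym (⊕-identityʳ (𝟘 _))
  lc-⊕ (x ∷ a) (y ∷ b) (e ∷ es) = begin
    (x + y) ⊙ e ⊕ lc (a ⊕ b) es             ≡⟨ cong₂ _⊕_ (⊙-distribʳ x y e) (lc-⊕ a b es) ⟩
    (x ⊙ e ⊕ y ⊙ e) ⊕ (lc a es ⊕ lc b es)   ≡⟨ xy⊕zw≡xz⊕yw (x ⊙ e) (y ⊙ e) (lc a es) (lc b es) ⟩
    (x ⊙ e ⊕ lc a es) ⊕ (y ⊙ e ⊕ lc b es)   ∎
    where open ≡-Reasoning

  lc-⊙ : ∀ {k l} c (a : Vec K l) (es : Vec (Vec K k) l) → lc (c ⊙ a) es ≡ c ⊙ lc a es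
  lc-⊙ c []      []       = sym (⊙-zeroʳ c)
  lc-⊙ c (x ∷ a) (e ∷ es) = begin
    (c * x) ⊙ e ⊕ lc (c ⊙ a) es    ≡⟨ cong₂ _⊕_ (⊙-assoc c x e) (lc-⊙ c a es) ⟩
    c ⊙ (x ⊙ e) ⊕ c ⊙ lc a es      ≡⟨ sym (⊙-distribˡ c (x ⊙ e) (lc a es)) ⟩
    c ⊙ (x ⊙ e ⊕ lc a es)          ∎
    where open ≡-Reasoning

  lc-𝟘 : ∀ {k l} (es : Vec (Vec K k) l) → lc (𝟘 l) es ≡ 𝟘 k
  lc-𝟘 []       = refl
  lc-𝟘 (e ∷ es) = trans (cong₂ _⊕_ (⊙-zeroˡ e) (lc-𝟘 es)) (⊕-identityʳ _)

  lc-lc : ∀ {k m l} (cs : Vec K l) (rows : Vec (Vec K m) l) (es : Vec (Vec K k) m) →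
          lc cs (map (λ a → lc a es) rows) ≡ lc (lc cs rows) es
  lc-lc []       []         es = sym (lc-𝟘 es)
  lc-lc (c ∷ cs) (r ∷ rows) es = begin
    c ⊙ lc r es ⊕ lc cs (map (λ a → lc a es) rows)  ≡⟨ cong₂ _⊕_ (sym (lc-⊙ c r es)) (lc-lc cs rows es) ⟩
    lc (c ⊙ r) es ⊕ lc (lc cs rows) es              ≡⟨ sym (lc-⊕ (c ⊙ r) (lc cs rows) es) ⟩
    lc (c ⊙ r ⊕ lc cs rows) es                      ∎
    where open ≡-Reasoning

  unitVec : ∀ {l} → Fin l → Vec K l
  unitVec {suc l} fzero    = 1# ∷ 𝟘 l
  unitVec {suc l} (fsuc i) = 0# ∷ unitVec i

  lc-unitVec : ∀ {k l} (i : Fin l) (es : Vec (Vec K k) l) → lc (unitVec i) es ≡ lookup es i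
  lc-unitVec fzero    (e ∷ es) = trans (cong₂ _⊕_ (⊙-identity e) (lc-𝟘 es)) (⊕-identityʳ e)
  lc-unitVec (fsuc i) (e ∷ es) = trans (cong₂ _⊕_ (⊙-zeroˡ e) (lc-unitVec i es)) (⊕-identityˡ _)

  Nontrivial : ∀ {l} → Vec K l → Set
  Nontrivial []       = ⊥
  Nontrivial (c ∷ cs) = c ≢ 0# ⊎ Nontrivial cs

  ¬Nontrivial-𝟘 : ∀ {l} → ¬ Nontrivial (𝟘 l)
  ¬Nontrivial-𝟘 {suc l} (inj₁ 0≢0) = 0≢0 refl
  ¬Nontrivial-𝟘 {suc l} (inj₂ nt)  = ¬Nontrivial-𝟘 nt

  LinearlyDependent : ∀ {k l} → Vec (Vec K k) l → Set
  LinearlyDependent {l = l} rs = Σ (Vec K l) λ cs → Nontrivial cs × lc cs rs ≡ 𝟘 _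

module Dependence {q : ℕ} (F : FiniteField q) where
  open import Data.Nat.Properties using (m<n⇒m<1+n)
  open import Data.Vec.Relation.Unary.All using (All; []; _∷_)
  import Data.Vec.Relation.Unary.All as All
  import Data.Vec.Relation.Unary.All.Properties as All

  open CoordinateSpace F

  headSum : ∀ {k l} → Vec K l → Vec (Vec K (suc k)) l → K
  headSum []       []       = 0#
  headSum (c ∷ cs) (r ∷ rs) = c * head r + headSum cs rs

  lc-∷ : ∀ {k l} (cs : Vec K l) (rs : Vec (Vec K (suc k)) l) →
         lc cs rs ≡ headSum cs rs ∷ lc cs (map tail rs)
  lc-∷ []       []               = refl
  lc-∷ (c ∷ cs) ((x ∷ r) ∷ rs) rewrite lc-∷ cs rs = refl

  headSum-zero : ∀ {k l} (cs : Vec K l) (rs : Vec (Vec K (suc k)) l) →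
                 All (λ r → head r ≡ 0#) rs → headSum cs rs ≡ 0#
  headSum-zero []       []       []         = refl
  headSum-zero (c ∷ cs) (r ∷ rs) (r₀≡0 ∷ h) rewrite r₀≡0 | headSum-zero cs rs h =
    trans (+-identityʳ _) (zeroʳ c)

  record Pivoted {k l : ℕ} (rs : Vec (Vec K (suc k)) (suc l)) : Set where
    field
      pivot    : Vec K (suc k)
      others   : Vec (Vec K (suc k)) l
      head≢0   : head pivot ≢ 0#
      reorder  : ∀ c cs → Σ (Vec K (suc l)) λ cs′ →
                 (Nontrivial (c ∷ cs) → Nontrivial cs′) × lc (c ∷ cs) (pivot ∷ others) ≡ lc cs′ rs

  findPivot : ∀ {k l} (rs : Vec (Vec K (suc k)) (suc l)) → All (λ r → head r ≡ 0#) rs ⊎ Pivoted rs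
  findPivot (r ∷ rs) with head r ≟ 0#
  ... | no r₀≢0 = inj₂ record { pivot = r ; others = rs ; head≢0 = r₀≢0 ; reorder = λ c cs → c ∷ cs , id , refl }
  findPivot (r ∷ [])      | yes r₀≡0 = inj₁ (r₀≡0 ∷ [])
  findPivot (r ∷ r′ ∷ rs) | yes r₀≡0 with findPivot (r′ ∷ rs)
  ... | inj₁ heads≡0 = inj₁ (r₀≡0 ∷ heads≡0)
  ... | inj₂ P = inj₂ record { pivot = pivot ; others = r ∷ others ; head≢0 = head≢0 ; reorder = reorder′ }
    where
    open Pivoted P
    reorder′ : ∀ c cs → Σ _ λ cs′ → (Nontrivial (c ∷ cs) → Nontrivial cs′) ×
               lc (c ∷ cs) (pivot ∷ r ∷ others) ≡ lc cs′ (r ∷ r′ ∷ rs)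
    reorder′ c (d ∷ cs) with reorder c cs
    ... | cs′ , nontrivial , eq = d ∷ cs′ , nontrivial′ ,
          trans (x⊕yz≡y⊕xz (c ⊙ pivot) (d ⊙ r) _) (cong (d ⊙ r ⊕_) eq)
      where
      nontrivial′ : Nontrivial (c ∷ d ∷ cs) → Nontrivial (d ∷ cs′)
      nontrivial′ (inj₁ c≢0)        = inj₂ (nontrivial (inj₁ c≢0))
      nontrivial′ (inj₂ (inj₁ d≢0)) = inj₁ d≢0
      nontrivial′ (inj₂ (inj₂ nt))  = inj₂ (nontrivial (inj₂ nt))

  weighted : ∀ {k l} (t : Vec K k → K) → Vec K l → Vec (Vec K k) l → K
  weighted t []       []       = 0#
  weighted t (d ∷ ds) (s ∷ rs) = d * t s + weighted t ds rs

  lc-shear : ∀ {k l} (t : Vec K k → K) (p : Vec K k) (ds : Vec K l) (rs : Vec (Vec K k) l) →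
             lc ds (map (λ s → s ⊕ t s ⊙ p) rs) ≡ lc ds rs ⊕ weighted t ds rs ⊙ p
  lc-shear t p []       []       = sym (trans (cong (𝟘 _ ⊕_) (⊙-zeroˡ p)) (⊕-identityʳ _))
  lc-shear t p (d ∷ ds) (s ∷ rs) = begin
    d ⊙ (s ⊕ t s ⊙ p) ⊕ lc ds (map (λ s → s ⊕ t s ⊙ p) rs)
      ≡⟨ cong₂ _⊕_ (⊙-distribˡ d s (t s ⊙ p)) (lc-shear t p ds rs) ⟩
    (d ⊙ s ⊕ d ⊙ (t s ⊙ p)) ⊕ (lc ds rs ⊕ W ⊙ p)
      ≡⟨ xy⊕zw≡xz⊕yw (d ⊙ s) _ (lc ds rs) _ ⟩
    (d ⊙ s ⊕ lc ds rs) ⊕ (d ⊙ (t s ⊙ p) ⊕ W ⊙ p)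
      ≡⟨ cong ((d ⊙ s ⊕ lc ds rs) ⊕_) (trans (cong (_⊕ W ⊙ p) (sym (⊙-assoc d (t s) p)))
                                            (sym (⊙-distribʳ (d * t s) W p))) ⟩
    (d ⊙ s ⊕ lc ds rs) ⊕ (d * t s + W) ⊙ p ∎
    where
    open ≡-Reasoning
    W = weighted t ds rs

  head-⊕⊙ : ∀ {k} (u p : Vec K (suc k)) c → head (u ⊕ c ⊙ p) ≡ head u + c * head p
  head-⊕⊙ (x ∷ u) (y ∷ p) c = refl

  Vec₀-unique : (u : Vec K 0) → u ≡ []
  Vec₀-unique [] = refl

  -- Gaussian elimination on the first coordinate.
  more-vectors-than-coordinates-dependent :
    ∀ k {l} → k < l → (rs : Vec (Vec K k) l) → LinearlyDependent rs
  more-vectors-than-coordinates-dependent zero {suc l} _ rs = 1# ∷ 𝟘 l , inj₁ (λ 1≡0 → 0≢1 (sym 1≡0)) , Vec₀-unique _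
  more-vectors-than-coordinates-dependent (suc k) {suc l} (s≤s k<l) rs with findPivot rs
  ... | inj₁ heads≡0 =
    let cs , nontrivial , tails≡0 = more-vectors-than-coordinates-dependent k (m<n⇒m<1+n k<l) (map tail rs)
    in cs , nontrivial , trans (lc-∷ cs rs) (cong₂ _∷_ (headSum-zero cs rs heads≡0) tails≡0)
  ... | inj₂ P = cs′ , nontrivial′ , trans (sym eq) (trans (⊕-comm (T ⊙ pivot) (lc ds others)) combination≡0)
    where
    open Pivoted P
    t : Vec K (suc k) → K
    t s = (- head s) * head pivot ⁻¹
    clear : Vec K (suc k) → Vec K (suc k)
    clear s = s ⊕ t s ⊙ pivot
    head-clear : ∀ s → head (clear s) ≡ 0#
    head-clear s@(x ∷ _) = begin
      head (clear s)                            ≡⟨ head-⊕⊙ s pivot (t s) ⟩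
      x + ((- x) * head pivot ⁻¹) * head pivot  ≡⟨ cong (x +_) (*-assoc (- x) _ _) ⟩
      x + (- x) * (head pivot ⁻¹ * head pivot)  ≡⟨ cong (λ c → x + (- x) * c) (⁻¹-inverseˡ head≢0) ⟩
      x + (- x) * 1#                            ≡⟨ cong (x +_) (*-identityʳ (- x)) ⟩
      x + - x                                   ≡⟨ -‿inverseʳ x ⟩
      0#                                        ∎
      where open ≡-Reasoning
    tails = more-vectors-than-coordinates-dependent k k<l (map tail (map clear others))
    ds = proj₁ tails
    T = weighted t ds others
    combination≡0 : lc ds others ⊕ T ⊙ pivot ≡ 𝟘 (suc k)
    combination≡0 = trans (sym (lc-shear t pivot ds others))
      (trans (lc-∷ ds (map clear others))
             (cong₂ _∷_ (headSum-zero ds (map clear others) (All.map⁺ (All.universal head-clear others)))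
                        (proj₂ (proj₂ tails))))
    reordered = reorder T ds
    cs′ = proj₁ reordered
    nontrivial′ = proj₁ (proj₂ reordered) (inj₂ (proj₁ (proj₂ tails)))
    eq = proj₂ (proj₂ reordered)

  Span-dependent : ∀ {n k l} → k < l → (us : Vec (Vec K n) l) (bs : Vec (Vec K n) k) →
                   (∀ i → Geometry.Span F n bs (lookup us i)) → LinearlyDependent us
  Span-dependent {n} {k} k<l us bs spanned =
    let cs , nontrivial , rows≡0 = more-vectors-than-coordinates-dependent k k<l rows in
    cs , nontrivial , (begin
      lc cs us                          ≡⟨ cong (lc cs) (sym (map-coordinates us spanned)) ⟩
      lc cs (map (λ a → lc a bs) rows)  ≡⟨ lc-lc cs rows bs ⟩
      lc (lc cs rows) bs                ≡⟨ cong (λ a → lc a bs) rows≡0 ⟩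
      lc (𝟘 k) bs                       ≡⟨ lc-𝟘 bs ⟩
      𝟘 n                               ∎)
    where
    open ≡-Reasoning
    rows = tabulate (λ i → proj₁ (spanned i))
    map-coordinates : ∀ {l} (us : Vec (Vec K n) l) (spanned : ∀ i → Geometry.Span F n bs (lookup us i)) →
                      map (λ a → lc a bs) (tabulate (λ i → proj₁ (spanned i))) ≡ us
    map-coordinates []       spanned = refl
    map-coordinates (u ∷ us) spanned =
      cong₂ _∷_ (proj₂ (spanned fzero)) (map-coordinates us (λ i → spanned (fsuc i)))

  independent⇒¬dependent : ∀ {n l} (bs : Vec (Vec K n) l) → Geometry.LinearlyIndependent F n bs →
                            ¬ LinearlyDependent bs
  independent⇒¬dependent bs independent (cs , nontrivial , lc≡0) =
    ¬Nontrivial-𝟘 (subst Nontrivial (independent cs lc≡0) nontrivial)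

module Normalisation {q : ℕ} (F : FiniteField q) (n : ℕ) where
  open CoordinateSpace F
  open Geometry F n using (Normalised)

  leading : ∀ {k} → Vec K k → K
  leading []       = 0#
  leading (x ∷ xs) with x ≟ 0#
  ... | yes _ = leading xs
  ... | no  _ = x

  normalise : ∀ {k} → Vec K k → Vec K k
  normalise u = leading u ⁻¹ ⊙ u

  leading-≢0 : ∀ {k} (u : Vec K k) → u ≢ 𝟘 k → leading u ≢ 0#
  leading-≢0 []       u≢0 = ⊥-elim (u≢0 refl)
  leading-≢0 (x ∷ xs) u≢0 with x ≟ 0#
  ... | yes x≡0 = leading-≢0 xs (λ xs≡0 → u≢0 (cong₂ _∷_ x≡0 xs≡0))
  ... | no  x≢0 = x≢0

  ⊙-Normalised : ∀ {k} c (u : Vec K k) → u ≢ 𝟘 k → c * leading u ≡ 1# → Normalised (c ⊙ u)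
  ⊙-Normalised c []       u≢0 _ = u≢0 refl
  ⊙-Normalised c (x ∷ xs) u≢0 e with x ≟ 0#
  ... | yes x≡0 = inj₁ (trans (cong (c *_) x≡0) (zeroʳ c) ,
                        ⊙-Normalised c xs (λ xs≡0 → u≢0 (cong₂ _∷_ x≡0 xs≡0)) e)
  ... | no  _   = inj₂ e

  Normalised⇒leading≡1 : ∀ {k} (u : Vec K k) → Normalised u → leading u ≡ 1#
  Normalised⇒leading≡1 (x ∷ xs) (inj₁ (x≡0 , nxs)) with x ≟ 0#
  ... | yes _   = Normalised⇒leading≡1 xs nxs
  ... | no  x≢0 = ⊥-elim (x≢0 x≡0)
  Normalised⇒leading≡1 (x ∷ xs) (inj₂ x≡1) with x ≟ 0#
  ... | yes x≡0 = ⊥-elim (0≢1 (trans (sym x≡0) x≡1))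
  ... | no  _   = x≡1

  leading-⊙ : ∀ {k} {a} (u : Vec K k) → a ≢ 0# → leading (a ⊙ u) ≡ a * leading u
  leading-⊙ {a = a} []       a≢0 = sym (zeroʳ a)
  leading-⊙ {a = a} (x ∷ xs) a≢0 with (a * x) ≟ 0# | x ≟ 0#
  ... | yes _    | yes _   = leading-⊙ xs a≢0
  ... | yes ax≡0 | no x≢0  = ⊥-elim (*-≢0 a≢0 x≢0 ax≡0)
  ... | no ax≢0  | yes x≡0 = ⊥-elim (ax≢0 (trans (cong (a *_) x≡0) (zeroʳ a)))
  ... | no _     | no _    = refl

  normalise-Normalised : ∀ {k} (u : Vec K k) → u ≢ 𝟘 k → Normalised (normalise u)
  normalise-Normalised u u≢0 = ⊙-Normalised _ u u≢0 (⁻¹-inverseˡ (leading-≢0 u u≢0))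

  normalise-⊙ : ∀ {k} {a} (u : Vec K k) → Normalised u → a ≢ 0# → normalise (a ⊙ u) ≡ u
  normalise-⊙ {a = a} u nu a≢0 = begin
    leading (a ⊙ u) ⁻¹ ⊙ (a ⊙ u)  ≡⟨ cong (λ c → c ⁻¹ ⊙ (a ⊙ u)) (leading-⊙ u a≢0) ⟩
    (a * leading u) ⁻¹ ⊙ (a ⊙ u)  ≡⟨ cong (λ c → (a * c) ⁻¹ ⊙ (a ⊙ u)) (Normalised⇒leading≡1 u nu) ⟩
    (a * 1#) ⁻¹ ⊙ (a ⊙ u)         ≡⟨ cong (λ c → c ⁻¹ ⊙ (a ⊙ u)) (*-identityʳ a) ⟩
    a ⁻¹ ⊙ (a ⊙ u)                ≡⟨ ⊙-cancelˡ u a≢0 ⟩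
    u                             ∎
    where open ≡-Reasoning

  Normalised? : ∀ {k} (u : Vec K k) → Dec (Normalised u)
  Normalised? []       = no (λ ())
  Normalised? (x ∷ xs) with x ≟ 1#
  ... | yes x≡1 = yes (inj₂ x≡1)
  ... | no  x≢1 with x ≟ 0# | Normalised? xs
  ...   | yes x≡0 | yes nxs = yes (inj₁ (x≡0 , nxs))
  ...   | yes _   | no ¬nxs = no λ { (inj₁ (_ , nxs)) → ¬nxs nxs ; (inj₂ x≡1) → x≢1 x≡1 }
  ...   | no  x≢0 | _       = no λ { (inj₁ (x≡0 , _)) → x≢0 x≡0 ; (inj₂ x≡1) → x≢1 x≡1 }

module Enumeration {q : ℕ} (F : FiniteField q) where
  open import Data.List using (List; cartesianProductWith; allFin)
  import Data.List as List
  open import Data.List.Membership.Propositional using (_∈_)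
  open import Data.List.Membership.Propositional.Properties using (∈-allFin; ∈-cartesianProductWith⁺)
  open import Data.List.Relation.Unary.Any using (here)
  open import Data.List.Relation.Unary.Unique.Propositional using (Unique)
  import Data.List.Relation.Unary.Unique.Propositional.Properties as Unique
  open import Data.List.Relation.Unary.AllPairs using ([]; _∷_)
  import Data.List.Relation.Unary.All as ListAll

  open CoordinateSpace F

  allVec : ∀ k → List (Vec K k)
  allVec zero    = List.[ [] ]
  allVec (suc k) = cartesianProductWith _∷_ (allFin q) (allVec k)

  ∈-allVec : ∀ {k} (u : Vec K k) → u ∈ allVec k
  ∈-allVec []       = here refl
  ∈-allVec (x ∷ u) = ∈-cartesianProductWith⁺ _∷_ (∈-allFin x) (∈-allVec u)

  allVec-Unique : ∀ k → Unique (allVec k)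
  allVec-Unique zero    = ListAll.[] ∷ []
  allVec-Unique (suc k) =
    Unique.cartesianProductWith⁺ _∷_ ∷-injective (Unique.allFin⁺ q) (allVec-Unique k)
    where
    ∷-injective : ∀ {k} {x y : K} {u w : Vec K k} → x ∷ u ≡ y ∷ w → x ≡ y × u ≡ w
    ∷-injective refl = refl , refl

module Counting where
  open import Data.List using (List; []; _∷_; filter) renaming (map to mapL)
  open import Data.List.Properties using (length-map)
  open import Data.List.Membership.Propositional using (_∈_)
  open import Data.List.Membership.Propositional.Properties using (∈-filter⁺; ∈-filter⁻; ∈-map⁺; ∈-map⁻)
  open import Data.List.Relation.Unary.Unique.Propositional using (Unique)
  import Data.List.Relation.Unary.Unique.Propositional.Properties as Unique
  open import Data.List.Relation.Unary.AllPairs using ([]; _∷_)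
  import Data.List.Relation.Unary.All as All
  import Data.List.Relation.Unary.All.Properties as All
  open import Data.List.Relation.Unary.All using (All)


  record _≅_ {A B : Set} (P : A → Set) (Q : B → Set) : Set where
    field
      to      : A → B
      from    : B → A
      to-∈    : ∀ {a} → P a → Q (to a)
      from-∈  : ∀ {b} → Q b → P (from b)
      from∘to : ∀ {a} → P a → from (to a) ≡ a
      to∘from : ∀ {b} → Q b → to (from b) ≡ b

  module _ {A : Set} where

    HasSize-cong : ∀ {P Q : A → Set} {k} → (∀ a → P a ⇔ Q a) → P HasSize k → Q HasSize k
    HasSize-cong P⇔Q (xs , len , unique , P⇔∈) =
      xs , len , unique , λ a → mk⇔ (Equivalence.to (P⇔∈ a) ∘ Equivalence.from (P⇔Q a))
                                    (Equivalence.to (P⇔Q a) ∘ Equivalence.from (P⇔∈ a))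

    empty-HasSize-0 : ∀ {P : A → Set} → (∀ a → ¬ P a) → P HasSize 0
    empty-HasSize-0 ¬P = [] , refl , [] , λ a → mk⇔ (λ pa → ⊥-elim (¬P a pa)) (λ ())

    Decidable-HasSize : ∀ {P : A → Set} (all : List A) → (∀ a → a ∈ all) → Unique all →
                        Decidable P → ∃[ k ] P HasSize k
    Decidable-HasSize all ∈-all all-unique P? =
      _ , filter P? all , refl , Unique.filter⁺ P? all-unique ,
      λ a → mk⇔ (∈-filter⁺ P? (∈-all a)) (proj₂ ∘ ∈-filter⁻ P? {xs = all})

  module _ {A B : Set} {P : A → Set} {Q : B → Set} (P≅Q : P ≅ Q) where
    open _≅_ P≅Q

    to-injective : ∀ {a a′} → P a → P a′ → to a ≡ to a′ → a ≡ a′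
    to-injective pa pa′ e = trans (sym (from∘to pa)) (trans (cong from e) (from∘to pa′))

    private
      map-Unique : ∀ {xs} → All P xs → Unique xs → Unique (mapL to xs)
      map-Unique {[]}     _             _                = []
      map-Unique {x ∷ xs} (px All.∷ ps) (x∉xs ∷ unique) =
        All.map⁺ (All.zipWith (λ (py , x≢y) → x≢y ∘ to-injective px py) (ps , x∉xs))
        ∷ map-Unique ps unique

    HasSize-≅ : ∀ {k} → P HasSize k → Q HasSize k
    HasSize-≅ (xs , refl , unique , P⇔∈) =
      mapL to xs , length-map to xs , map-Unique (All.tabulate (Equivalence.from (P⇔∈ _))) unique ,
      λ b → mk⇔ (λ qb → subst (_∈ mapL to xs) (to∘from qb) (∈-map⁺ to (Equivalence.to (P⇔∈ _) (from-∈ qb))))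
                (λ b∈ → let a , a∈ , b≡ = ∈-map⁻ to b∈ in subst Q (sym b≡) (to-∈ (Equivalence.from (P⇔∈ a) a∈)))

module Forms {q : ℕ} (F : FiniteField q) (n : ℕ) where
  open import Data.Vec.Properties using (lookup-zipWith; lookup-map)

  open CoordinateSpace F
  open Geometry F n using (V; PolarityForm; herm; quad; hermitian; polarForm; quadratic; IsInvolutoryAutomorphism)
  open import Algebra.Solver.Ring.NaturalCoefficients.Default
    (CommutativeRing.commutativeSemiring commutativeRing) using (solve; _:+_; _:*_; _:=_; con)

  record ReflexiveForm (f : V → V → K) : Set where
    field
      f-+ : ∀ x y z → f (x ⊕ y) z ≡ f x z + f y z
      f-⊙ : ∀ a x z → f (a ⊙ x) z ≡ a * f x z
      orthogonal-sym : ∀ x y → f x y ≡ 0# → f y x ≡ 0#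

  lookup-⊕ : ∀ (x y : V) i → lookup (x ⊕ y) i ≡ lookup x i + lookup y i
  lookup-⊕ x y i = lookup-zipWith _+_ i x y

  lookup-⊙ : ∀ a (x : V) i → lookup (a ⊙ x) i ≡ a * lookup x i
  lookup-⊙ a x i = lookup-map i (a *_) x

  module Hermitian (σ : K → K) (isInvolution : IsInvolutoryAutomorphism σ) (H : Fin n → Fin n → K)
                   (H-hermitian : ∀ i j → H j i ≡ σ (H i j)) where
    open IsInvolutoryAutomorphism isInvolution
    h = hermitian σ H

    σ-0 : σ 0# ≡ 0#
    σ-0 = x+x≈x⇒x≈0 (σ 0#) (trans (sym (σ-+ 0# 0#)) (cong σ (+-identityʳ 0#)))

    h-+ : ∀ x y z → h (x ⊕ y) z ≡ h x z + h y z
    h-+ x y z = begin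
      ∑ (λ i → ∑ (λ j → lookup (x ⊕ y) i * H i j * σ (lookup z j)))
        ≡⟨ ∑-cong {n} (λ i → ∑-cong {n} (λ j → trans (cong (λ t → t * H i j * σ (lookup z j)) (lookup-⊕ x y i))
             (solve 4 (λ a b c d → (a :+ b) :* c :* d := a :* c :* d :+ b :* c :* d) refl
                (lookup x i) (lookup y i) (H i j) (σ (lookup z j))))) ⟩
      ∑ (λ i → ∑ (λ j → lookup x i * H i j * σ (lookup z j) + lookup y i * H i j * σ (lookup z j)))
        ≡⟨ ∑-cong {n} (λ i → ∑-distrib-+ {n} _ _) ⟩
      ∑ (λ i → ∑ (λ j → lookup x i * H i j * σ (lookup z j)) + ∑ (λ j → lookup y i * H i j * σ (lookup z j)))
        ≡⟨ ∑-distrib-+ {n} _ _ ⟩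
      h x z + h y z ∎
      where open ≡-Reasoning

    h-⊙ : ∀ a x z → h (a ⊙ x) z ≡ a * h x z
    h-⊙ a x z = begin
      ∑ (λ i → ∑ (λ j → lookup (a ⊙ x) i * H i j * σ (lookup z j)))
        ≡⟨ ∑-cong {n} (λ i → ∑-cong {n} (λ j → trans (cong (λ t → t * H i j * σ (lookup z j)) (lookup-⊙ a x i))
             (solve 4 (λ a b c d → a :* b :* c :* d := a :* (b :* c :* d)) refl
                a (lookup x i) (H i j) (σ (lookup z j))))) ⟩
      ∑ (λ i → ∑ (λ j → a * (lookup x i * H i j * σ (lookup z j))))
        ≡⟨ ∑-cong {n} (λ i → *-distribˡ-∑ {n} a _) ⟩
      ∑ (λ i → a * ∑ (λ j → lookup x i * H i j * σ (lookup z j)))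
        ≡⟨ *-distribˡ-∑ {n} a _ ⟩
      a * h x z ∎
      where open ≡-Reasoning

    σ-h : ∀ x y → σ (h x y) ≡ h y x
    σ-h x y = begin
      σ (∑ (λ i → ∑ (λ j → lookup x i * H i j * σ (lookup y j))))
        ≡⟨ ∑-homo σ σ-+ σ-0 {n} _ ⟩
      ∑ (λ i → σ (∑ (λ j → lookup x i * H i j * σ (lookup y j))))
        ≡⟨ ∑-cong {n} (λ i → ∑-homo σ σ-+ σ-0 {n} _) ⟩
      ∑ (λ i → ∑ (λ j → σ (lookup x i * H i j * σ (lookup y j))))
        ≡⟨ ∑-cong {n} (λ i → ∑-cong {n} (λ j → σ-term i j)) ⟩
      ∑ (λ i → ∑ (λ j → lookup y j * H j i * σ (lookup x i)))
        ≡⟨ ∑-comm {n} {n} (λ i j → lookup y j * H j i * σ (lookup x i)) ⟩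
      h y x ∎
      where
      open ≡-Reasoning
      σ-term : ∀ i j → σ (lookup x i * H i j * σ (lookup y j)) ≡ lookup y j * H j i * σ (lookup x i)
      σ-term i j = begin
        σ (lookup x i * H i j * σ (lookup y j))      ≡⟨ σ-* _ _ ⟩
        σ (lookup x i * H i j) * σ (σ (lookup y j))  ≡⟨ cong₂ _*_ (σ-* _ _) (σ-inv _) ⟩
        σ (lookup x i) * σ (H i j) * lookup y j      ≡⟨ cong (λ t → σ (lookup x i) * t * lookup y j) (sym (H-hermitian i j)) ⟩
        σ (lookup x i) * H j i * lookup y j          ≡⟨ solve 3 (λ a b c → a :* b :* c := c :* b :* a) refl
                                                          (σ (lookup x i)) (H j i) (lookup y j) ⟩
        lookup y j * H j i * σ (lookup x i)          ∎

    reflexive : ReflexiveForm h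
    reflexive = record
      { f-+ = h-+
      ; f-⊙ = h-⊙
      ; orthogonal-sym = λ x y hxy≡0 → trans (sym (σ-h x y)) (trans (cong σ hxy≡0) σ-0)
      }

  module Quadratic (A : Fin n → Fin n → K) where
    Q = quadratic A

    -- The polar form written out without subtractions.
    B : V → V → K
    B x y = ∑ (λ i → ∑ (λ j → A i j * (lookup x i * lookup y j + lookup y i * lookup x j)))

    Q-⊕ : ∀ x y → Q (x ⊕ y) ≡ (Q x + Q y) + B x y
    Q-⊕ x y = begin
      ∑ (λ i → ∑ (λ j → A i j * lookup (x ⊕ y) i * lookup (x ⊕ y) j))
        ≡⟨ ∑-cong {n} (λ i → ∑-cong {n} (λ j → trans (cong₂ (λ s t → A i j * s * t) (lookup-⊕ x y i) (lookup-⊕ x y j))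
             (solve 5 (λ a xi yi xj yj → a :* (xi :+ yi) :* (xj :+ yj)
                         := (a :* xi :* xj :+ a :* yi :* yj) :+ a :* (xi :* yj :+ yi :* xj)) refl
                (A i j) (lookup x i) (lookup y i) (lookup x j) (lookup y j)))) ⟩
      ∑ (λ i → ∑ (λ j → (A i j * lookup x i * lookup x j + A i j * lookup y i * lookup y j)
                        + A i j * (lookup x i * lookup y j + lookup y i * lookup x j)))
        ≡⟨ ∑-cong {n} (λ i → trans (∑-distrib-+ {n} _ _) (cong₂ _+_ (∑-distrib-+ {n} _ _) refl)) ⟩
      ∑ (λ i → (∑ (λ j → A i j * lookup x i * lookup x j) + ∑ (λ j → A i j * lookup y i * lookup y j))
               + ∑ (λ j → A i j * (lookup x i * lookup y j + lookup y i * lookup x j)))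
        ≡⟨ trans (∑-distrib-+ {n} _ _) (cong₂ _+_ (∑-distrib-+ {n} _ _) refl) ⟩
      (Q x + Q y) + B x y ∎
      where open ≡-Reasoning

    polarForm≡B : ∀ x y → polarForm A x y ≡ B x y
    polarForm≡B x y = begin
      Q (x ⊕ y) + - Q x + - Q y                  ≡⟨ cong (λ t → t + - Q x + - Q y) (Q-⊕ x y) ⟩
      ((Q x + Q y) + B x y) + - Q x + - Q y      ≡⟨ solve 5 (λ a b p na nb → ((a :+ b) :+ p) :+ na :+ nb
                                                               := p :+ (a :+ na) :+ (b :+ nb)) refl
                                                      (Q x) (Q y) (B x y) (- Q x) (- Q y) ⟩
      B x y + (Q x + - Q x) + (Q y + - Q y)      ≡⟨ cong₂ (λ s t → B x y + s + t) (-‿inverseʳ (Q x)) (-‿inverseʳ (Q y)) ⟩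
      B x y + 0# + 0#                            ≡⟨ trans (+-identityʳ _) (+-identityʳ _) ⟩
      B x y                                      ∎
      where open ≡-Reasoning

    B-+ : ∀ x y z → B (x ⊕ y) z ≡ B x z + B y z
    B-+ x y z = trans (∑-cong {n} (λ i → trans (∑-cong {n} (λ j → trans
      (cong₂ (λ s t → A i j * (s * lookup z j + lookup z i * t)) (lookup-⊕ x y i) (lookup-⊕ x y j))
      (solve 7 (λ a xi yi xj yj zi zj → a :* ((xi :+ yi) :* zj :+ zi :* (xj :+ yj))
                  := a :* (xi :* zj :+ zi :* xj) :+ a :* (yi :* zj :+ zi :* yj)) refl
         (A i j) (lookup x i) (lookup y i) (lookup x j) (lookup y j) (lookup z i) (lookup z j))))
      (∑-distrib-+ {n} _ _))) (∑-distrib-+ {n} _ _)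

    B-⊙ : ∀ a x z → B (a ⊙ x) z ≡ a * B x z
    B-⊙ a x z = trans (∑-cong {n} (λ i → trans (∑-cong {n} (λ j → trans
      (cong₂ (λ s t → A i j * (s * lookup z j + lookup z i * t)) (lookup-⊙ a x i) (lookup-⊙ a x j))
      (solve 6 (λ c b xi xj zi zj → b :* ((c :* xi) :* zj :+ zi :* (c :* xj))
                  := c :* (b :* (xi :* zj :+ zi :* xj))) refl
         a (A i j) (lookup x i) (lookup x j) (lookup z i) (lookup z j))))
      (*-distribˡ-∑ {n} a _))) (*-distribˡ-∑ {n} a _)

    B-sym : ∀ x y → B x y ≡ B y x
    B-sym x y = ∑-cong {n} (λ i → ∑-cong {n} (λ j → cong (A i j *_) (+-comm _ _)))

    reflexive : ReflexiveForm (polarForm A)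
    reflexive = record
      { f-+ = λ x y z → trans (polarForm≡B (x ⊕ y) z)
                          (trans (B-+ x y z) (sym (cong₂ _+_ (polarForm≡B x z) (polarForm≡B y z))))
      ; f-⊙ = λ a x z → trans (polarForm≡B (a ⊙ x) z) (trans (B-⊙ a x z) (cong (a *_) (sym (polarForm≡B x z))))
      ; orthogonal-sym = λ x y Bxy≡0 → trans (polarForm≡B y x)
                           (trans (B-sym y x) (trans (sym (polarForm≡B x y)) Bxy≡0))
      }

  PolarityForm⇒ReflexiveForm : ∀ {f} → PolarityForm f → ReflexiveForm f
  PolarityForm⇒ReflexiveForm (herm σ isInvolution H H-hermitian _) = Hermitian.reflexive σ isInvolution H H-hermitian
  PolarityForm⇒ReflexiveForm (quad A _ _)                          = Quadratic.reflexive A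

module SubspaceGeometry {q : ℕ} (F : FiniteField q) (n : ℕ) where
  open import Data.Nat.Properties using (n<1+n)
  import Data.Fin.Properties as Fin
  import Data.List.Relation.Unary.Any as Any
  open import Data.Vec.Properties using (≡-dec)

  open CoordinateSpace F
  open Dependence F
  open Enumeration F
  open Geometry F n using (V; Subspace; IsSubspace; HasDim; Span; LinearlyIndependent; _∩_; SameSet)

  0∈ : ∀ {W} → IsSubspace W → W (𝟘 n)
  0∈ (0∈W , _ , _) = 0∈W

  ⊕∈ : ∀ {W} → IsSubspace W → ∀ {u w} → W u → W w → W (u ⊕ w)
  ⊕∈ (_ , ⊕∈W , _) {u} {w} = ⊕∈W u w

  ⊙∈ : ∀ {W} → IsSubspace W → ∀ a {u} → W u → W (a ⊙ u)
  ⊙∈ (_ , _ , ⊙∈W) a {u} = ⊙∈W a u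

  ∈-cancelˡ : ∀ {W} → IsSubspace W → ∀ {p x} → W p → W (p ⊕ x) → W x
  ∈-cancelˡ {W} W-sub {p} {x} p∈W p⊕x∈W = subst W p⊕x⊖p≡x (⊕∈ W-sub p⊕x∈W (⊙∈ W-sub (- 1#) p∈W))
    where
    p⊕x⊖p≡x : (p ⊕ x) ⊖ p ≡ x
    p⊕x⊖p≡x = trans (cong (_⊖ p) (⊕-comm p x))
                (trans (⊕-assoc x p _) (trans (cong (x ⊕_) (⊕-inverseʳ p)) (⊕-identityʳ x)))

  ∈-unscale : ∀ {W} → IsSubspace W → ∀ {a x} → a ≢ 0# → W (a ⊙ x) → W x
  ∈-unscale {W} W-sub {a} {x} a≢0 ax∈W = subst W (⊙-cancelˡ x a≢0) (⊙∈ W-sub (a ⁻¹) ax∈W)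

  ∩-comm : (L L′ : Subspace) → SameSet (L ∩ L′) (L′ ∩ L)
  ∩-comm L L′ x = mk⇔ (λ (l , l′) → l′ , l) (λ (l′ , l) → l , l′)

  HasDim-cong : ∀ {W W′ k} → SameSet W W′ → HasDim W k → HasDim W′ k
  HasDim-cong W⇔W′ (bs , independent , W⇔Span) =
    bs , independent , λ x → mk⇔ (Equivalence.to (W⇔Span x) ∘ Equivalence.from (W⇔W′ x))
                                 (Equivalence.to (W⇔W′ x) ∘ Equivalence.from (W⇔Span x))

  Span? : ∀ {k} (bs : Vec V k) y → Dec (Span bs y)
  Span? {k} bs y with Any.any? (λ cs → ≡-dec _≟_ (lc cs bs) y) (allVec k)
  ... | yes found = yes (Any.satisfied found)
  ... | no ¬found = no λ (cs , eq) → ¬found (Any.map (λ { refl → eq }) (∈-allVec cs))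

  HasDim⇒Decidable : ∀ {W k} → HasDim W k → Decidable W
  HasDim⇒Decidable (bs , _ , W⇔Span) y with Span? bs y
  ... | yes s = yes (Equivalence.from (W⇔Span y) s)
  ... | no ¬s = no (¬s ∘ Equivalence.to (W⇔Span y))

  basis-∈ : ∀ {W k} (dim : HasDim W k) i → W (lookup (proj₁ dim) i)
  basis-∈ (bs , _ , W⇔Span) i = Equivalence.from (W⇔Span _) (unitVec i , lc-unitVec i bs)

  record Splitting (L L′ : Subspace) : Set where
    field
      v     : V
      v∈L   : L v
      v∉L′  : ¬ L′ v
      split : ∀ y → L y → Σ K λ a → Σ V λ r → (L ∩ L′) r × y ≡ r ⊕ a ⊙ v

  module _ {L L′ : Subspace} {k : ℕ} (L-sub : IsSubspace L) (L′-sub : IsSubspace L′)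
           (dim : HasDim L (suc k)) (dim∩ : HasDim (L ∩ L′) k) where
    private
      es = proj₁ dim
      bs = proj₁ dim∩
      L⇔Span  = proj₂ (proj₂ dim)
      ∩⇔Span  = proj₂ (proj₂ dim∩)

    ∃-∉ : ∃[ v ] (L v × ¬ L′ v)
    ∃-∉ with Fin.any? (λ i → ¬? (HasDim⇒Decidable dim∩ (lookup es i)))
    ... | yes (i , eᵢ∉∩) = lookup es i , basis-∈ dim i , λ eᵢ∈L′ → eᵢ∉∩ (basis-∈ dim i , eᵢ∈L′)
    ... | no ¬found = ⊥-elim (independent⇒¬dependent es (proj₁ (proj₂ dim))
                        (Span-dependent (n<1+n k) es bs (λ i → Equivalence.to (∩⇔Span _) (eᵢ∈∩ i))))
      where
      eᵢ∈∩ : ∀ i → (L ∩ L′) (lookup es i)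
      eᵢ∈∩ i with HasDim⇒Decidable dim∩ (lookup es i)
      ... | yes eᵢ∈∩ = eᵢ∈∩
      ... | no eᵢ∉∩ = ⊥-elim (¬found (i , eᵢ∉∩))

    ∉L′⇒independent : ∀ {v} → ¬ L′ v → ¬ LinearlyDependent (v ∷ bs)
    ∉L′⇒independent {v} v∉L′ (cv ∷ cb , nontrivial , cv⊙v⊕B≡0) with cv ≟ 0#
    ... | no cv≢0 = v∉L′ (∈-unscale L′-sub cv≢0
      (subst L′ (sym (⊕-inverseʳ-unique B (cv ⊙ v) (trans (⊕-comm B (cv ⊙ v)) cv⊙v⊕B≡0)))
             (⊙∈ L′-sub (- 1#) (proj₂ (Equivalence.from (∩⇔Span B) (cb , refl))))))
      where B = lc cb bs
    ... | yes cv≡0 = independent⇒¬dependent bs (proj₁ (proj₂ dim∩)) (cb , nontrivial-cb nontrivial , B≡0)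
      where
      B≡0 : lc cb bs ≡ 𝟘 n
      B≡0 = trans (sym (⊕-identityˡ _))
              (trans (cong (_⊕ lc cb bs) (sym (trans (cong (_⊙ v) cv≡0) (⊙-zeroˡ v)))) cv⊙v⊕B≡0)
      nontrivial-cb : Nontrivial (cv ∷ cb) → Nontrivial cb
      nontrivial-cb (inj₁ cv≢0) = ⊥-elim (cv≢0 cv≡0)
      nontrivial-cb (inj₂ nt)   = nt

    -- y, v and the basis of L ∩ L′ are k + 2 vectors in the (k + 1)-dimensional L,
    -- and by ∉L′⇒independent the coefficient of y in a dependence among them is non-zero.
    split-off : ∀ {v} → L v → ¬ L′ v → ∀ y → L y → Σ K λ a → Σ V λ r → (L ∩ L′) r × y ≡ r ⊕ a ⊙ v
    split-off {v} v∈L v∉L′ y y∈L with Span-dependent (n<1+n (suc k)) (y ∷ v ∷ bs) es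
                       (λ { fzero → Equivalence.to (L⇔Span y) y∈L
                          ; (fsuc fzero) → Equivalence.to (L⇔Span v) v∈L
                          ; (fsuc (fsuc i)) → Equivalence.to (L⇔Span _) (proj₁ (basis-∈ dim∩ i)) })
    ... | cy ∷ cv ∷ cb , nontrivial , combination≡0 = solveFor (cy ≟ 0#)
      where
      B = lc cb bs
      B∈∩ : (L ∩ L′) B
      B∈∩ = Equivalence.from (∩⇔Span B) (cb , refl)
      W = cv ⊙ v ⊕ B
      W⊕cy≡0 : W ⊕ cy ⊙ y ≡ 𝟘 n
      W⊕cy≡0 = trans (⊕-comm W (cy ⊙ y)) combination≡0
      solveFor : Dec (cy ≡ 0#) → Σ K λ a → Σ V λ r → (L ∩ L′) r × y ≡ r ⊕ a ⊙ v
      solveFor (no cy≢0) = c * cv , c ⊙ B , (⊙∈ L-sub c (proj₁ B∈∩) , ⊙∈ L′-sub c (proj₂ B∈∩)) ,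
        (begin
          y                               ≡⟨ sym (⊙-cancelˡ y cy≢0) ⟩
          cy ⁻¹ ⊙ (cy ⊙ y)                ≡⟨ cong (cy ⁻¹ ⊙_) (⊕-inverseʳ-unique W (cy ⊙ y) W⊕cy≡0) ⟩
          cy ⁻¹ ⊙ ((- 1#) ⊙ (cv ⊙ v ⊕ B)) ≡⟨ sym (⊙-assoc (cy ⁻¹) (- 1#) W) ⟩
          c ⊙ (cv ⊙ v ⊕ B)                ≡⟨ ⊙-distribˡ c (cv ⊙ v) B ⟩
          c ⊙ (cv ⊙ v) ⊕ c ⊙ B            ≡⟨ cong (_⊕ c ⊙ B) (sym (⊙-assoc c cv v)) ⟩
          (c * cv) ⊙ v ⊕ c ⊙ B            ≡⟨ ⊕-comm ((c * cv) ⊙ v) (c ⊙ B) ⟩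
          c ⊙ B ⊕ (c * cv) ⊙ v            ∎)
        where
        open ≡-Reasoning
        c = cy ⁻¹ * - 1#
      solveFor (yes cy≡0) = ⊥-elim (∉L′⇒independent v∉L′ (cv ∷ cb , nontrivial-cv∷cb nontrivial , W≡0))
        where
        W≡0 : W ≡ 𝟘 n
        W≡0 = trans (sym (⊕-identityʳ W))
                (trans (cong (W ⊕_) (sym (trans (cong (_⊙ y) cy≡0) (⊙-zeroˡ y)))) W⊕cy≡0)
        nontrivial-cv∷cb : Nontrivial (cy ∷ cv ∷ cb) → Nontrivial (cv ∷ cb)
        nontrivial-cv∷cb (inj₁ cy≢0) = ⊥-elim (cy≢0 cy≡0)
        nontrivial-cv∷cb (inj₂ nt)   = nt

    splitting : Splitting L L′
    splitting = record { v = v ; v∈L = v∈L ; v∉L′ = v∉L′ ; split = split-off v∈L v∉L′ }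
      where
      v = proj₁ ∃-∉
      v∈L = proj₁ (proj₂ ∃-∉)
      v∉L′ = proj₂ (proj₂ ∃-∉)

module PolarGeometry {q : ℕ} (F : FiniteField q) (n : ℕ) {f : Vec (Fin q) n → Vec (Fin q) n → Fin q}
                     (reflexive : Forms.ReflexiveForm F n f) where
  import Data.Fin.Properties as Fin
  open import Relation.Nullary.Decidable using (_×-dec_)
  open import Function.Properties.Equivalence using () renaming (trans to ⇔-trans)

  open CoordinateSpace F
  open Normalisation F n
  open SubspaceGeometry F n
  open Forms.ReflexiveForm reflexive
  open Enumeration F
  open Counting
  open Geometry F n using (V; Subspace; IsSubspace; HasDim; Span; _∩_; SameSet; perp; Vertex; nbhdIn; _∪_; IsSwitchingSet)
  open import Algebra.Solver.Ring.NaturalCoefficients.Default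
    (CommutativeRing.commutativeSemiring commutativeRing) using (solve; _:+_; _:*_; _:=_; con)

  f-𝟘ˡ : ∀ z → f (𝟘 n) z ≡ 0#
  f-𝟘ˡ z = trans (cong (λ t → f t z) (sym (⊙-zeroˡ (𝟘 n)))) (trans (f-⊙ 0# (𝟘 n) z) (zeroˡ _))

  f-lc-≡0 : ∀ {l} (cs : Vec K l) (bs : Vec V l) x → (∀ i → f (lookup bs i) x ≡ 0#) → f (lc cs bs) x ≡ 0#
  f-lc-≡0 []       []       x _      = f-𝟘ˡ x
  f-lc-≡0 (c ∷ cs) (b ∷ bs) x bs⊥x = begin
    f (c ⊙ b ⊕ lc cs bs) x        ≡⟨ f-+ (c ⊙ b) (lc cs bs) x ⟩
    f (c ⊙ b) x + f (lc cs bs) x  ≡⟨ cong₂ _+_ (f-⊙ c b x) (f-lc-≡0 cs bs x (bs⊥x ∘ fsuc)) ⟩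
    c * f b x + 0#                ≡⟨ cong (λ s → c * s + 0#) (bs⊥x fzero) ⟩
    c * 0# + 0#                   ≡⟨ trans (+-identityʳ _) (zeroʳ c) ⟩
    0#                            ∎
    where open ≡-Reasoning

  f-⊖ : ∀ y z x → f (y ⊖ z) x ≡ f y x + - 1# * f z x
  f-⊖ y z x = trans (f-+ y _ x) (cong (f y x +_) (f-⊙ (- 1#) z x))

  perp-Span? : ∀ {k} (bs : Vec V k) x → perp f (Span bs) x ⊎ ∃[ i ] f (lookup bs i) x ≢ 0#
  perp-Span? bs x with Fin.any? (λ i → ¬? (f (lookup bs i) x ≟ 0#))
  ... | yes found = inj₂ found
  ... | no ¬found = inj₁ λ { r (cs , refl) → f-lc-≡0 cs bs x bsᵢ⊥x }
    where
    bsᵢ⊥x : ∀ i → f (lookup bs i) x ≡ 0#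
    bsᵢ⊥x i with f (lookup bs i) x ≟ 0#
    ... | yes ⊥x = ⊥x
    ... | no ¬⊥x = ⊥-elim (¬found (i , ¬⊥x))

  _∖_ : Subspace → Subspace → V → Set
  (L ∖ L′) y = L y × ¬ L′ y

  IsRadical : Subspace → Subspace → Set
  IsRadical L L′ = SameSet (L ∩ L′) (L ∩ perp f L)

  perp-∩-comm : ∀ {L L′ x} → perp f (L ∩ L′) x → perp f (L′ ∩ L) x
  perp-∩-comm x⊥R r (r∈L′ , r∈L) = x⊥R r (r∈L , r∈L′)

  module Side {L L′ : Subspace} (L-sub : IsSubspace L) (splitting : Splitting L L′)
              (radical : IsRadical L L′) where
    open Splitting splitting public

    radical-⊥ : ∀ {r x} → (L ∩ L′) r → L x → f r x ≡ 0#
    radical-⊥ {r} {x} r∈R x∈L = orthogonal-sym x r (proj₂ (Equivalence.to (radical r) r∈R) x x∈L)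

    ⊥L⇒radical : ∀ {r} → L r → (∀ x → L x → f x r ≡ 0#) → L′ r
    ⊥L⇒radical {r} r∈L r⊥L = proj₂ (Equivalence.from (radical r) (r∈L , r⊥L))

    f-split : ∀ a r x → f (r ⊕ a ⊙ v) x ≡ f r x + a * f v x
    f-split a r x = trans (f-+ r (a ⊙ v) x) (cong (f r x +_) (f-⊙ a v x))

    f-split-⊥ : ∀ a {r x} → f r x ≡ 0# → f (r ⊕ a ⊙ v) x ≡ a * f v x
    f-split-⊥ a {r} {x} r⊥x = trans (f-split a r x) (trans (cong (_+ a * f v x) r⊥x) (+-identityˡ _))

    coefficient : V → K
    coefficient y = f y v * f v v ⁻¹

    f[v,v]≢0 : f v v ≢ 0#
    f[v,v]≢0 f[v,v]≡0 = v∉L′ (⊥L⇒radical v∈L v⊥L)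
      where
      v⊥L : ∀ x → L x → f x v ≡ 0#
      v⊥L x x∈L with split x x∈L
      ... | a , r , r∈R , refl =
        trans (f-split-⊥ a (radical-⊥ r∈R v∈L)) (trans (cong (a *_) f[v,v]≡0) (zeroʳ a))

    split-coefficient≢0 : ∀ {a r} → L′ r → ¬ L′ (r ⊕ a ⊙ v) → a ≢ 0#
    split-coefficient≢0 {a} {r} r∈L′ y∉L′ refl =
      y∉L′ (subst L′ (sym (trans (cong (r ⊕_) (⊙-zeroˡ v)) (⊕-identityʳ r))) r∈L′)

    f[v,y]≢0 : ∀ {y} → (L ∖ L′) y → f v y ≢ 0#
    f[v,y]≢0 {y} (y∈L , y∉L′) f[v,y]≡0 with split y y∈L
    ... | a , r , r∈R , refl = *-≢0 (split-coefficient≢0 (proj₂ r∈R) y∉L′) f[v,v]≢0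
      (trans (sym (f-split-⊥ a (radical-⊥ r∈R v∈L))) (orthogonal-sym v _ f[v,y]≡0))

    coclique : ∀ {y y′} → (L ∖ L′) y → (L ∖ L′) y′ → f y′ y ≢ 0#
    coclique {y} (y∈L , y∉L′) (y′∈L , y′∉L′) with split _ y′∈L
    ... | a , r , r∈R , refl = λ f[y′,y]≡0 →
      *-≢0 (split-coefficient≢0 (proj₂ r∈R) y′∉L′) (f[v,y]≢0 (y∈L , y∉L′))
        (trans (sym (f-split-⊥ a (radical-⊥ r∈R y∈L))) f[y′,y]≡0)

    ⊥⇔v⊥ : ∀ {x y} → perp f (L ∩ L′) x → (L ∖ L′) y → f y x ≡ 0# ⇔ f v x ≡ 0#
    ⊥⇔v⊥ {x} {y} x⊥R (y∈L , y∉L′) with split y y∈L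
    ... | a , r , r∈R , refl = mk⇔
      (λ f[y,x]≡0 → *-cancelˡ-≡0 (f v x) a≢0 (trans (sym (f-split-⊥ a (x⊥R r r∈R))) f[y,x]≡0))
      (λ f[v,x]≡0 → trans (f-split-⊥ a (x⊥R r r∈R)) (trans (cong (a *_) f[v,x]≡0) (zeroʳ a)))
      where a≢0 = split-coefficient≢0 (proj₂ r∈R) y∉L′

    coefficient-split : ∀ a {r} → (L ∩ L′) r → coefficient (r ⊕ a ⊙ v) ≡ a
    coefficient-split a r∈R = begin
      f (_ ⊕ a ⊙ v) v * f v v ⁻¹  ≡⟨ cong (_* f v v ⁻¹) (f-split-⊥ a (radical-⊥ r∈R v∈L)) ⟩
      a * f v v * f v v ⁻¹        ≡⟨ *-assoc a _ _ ⟩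
      a * (f v v * f v v ⁻¹)      ≡⟨ cong (a *_) (⁻¹-inverseʳ f[v,v]≢0) ⟩
      a * 1#                      ≡⟨ *-identityʳ a ⟩
      a                           ∎
      where open ≡-Reasoning

  record Pencil : Set₁ where
    field
      L₁ L₂      : Subspace
      L₁-sub     : IsSubspace L₁
      L₂-sub     : IsSubspace L₂
      splitting₁ : Splitting L₁ L₂
      splitting₂ : Splitting L₂ L₁
      radical₁   : IsRadical L₁ L₂
      radical₂   : IsRadical L₂ L₁

    module S₁ = Side L₁-sub splitting₁ radical₁
    module S₂ = Side L₂-sub splitting₂ radical₂

    v = S₁.v
    w = S₂.v

    C₁ C₂ : V → Set
    C₁ y = Vertex f y × (L₁ ∖ L₂) y
    C₂ y = Vertex f y × (L₂ ∖ L₁) y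

  swap : Pencil → Pencil
  swap P = record { L₁ = L₂ ; L₂ = L₁ ; L₁-sub = L₂-sub ; L₂-sub = L₁-sub
                  ; splitting₁ = splitting₂ ; splitting₂ = splitting₁
                  ; radical₁ = radical₂ ; radical₂ = radical₁ }
    where open Pencil P

  -- φ sends r + a v to (r + a t) + a w. When t ⊕ t′ = 0, φ′ is the φ of the swapped pencil
  -- with t′ for t, and it inverts φ.
  module Transfer (P : Pencil) (t t′ : V) (t∈R : (Pencil.L₁ P ∩ Pencil.L₂ P) t) (t⊕t′≡0 : t ⊕ t′ ≡ 𝟘 n) where
    open Pencil P

    u u′ : V
    u  = (w ⊖ v) ⊕ t
    u′ = (v ⊖ w) ⊕ t′

    φ φ′ : V → V
    φ  y = y ⊕ S₁.coefficient y ⊙ u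
    φ′ z = z ⊕ S₂.coefficient z ⊙ u′

    u⊕u′≡0 : u ⊕ u′ ≡ 𝟘 n
    u⊕u′≡0 = begin
      ((w ⊖ v) ⊕ t) ⊕ ((v ⊖ w) ⊕ t′)  ≡⟨ xy⊕zw≡xz⊕yw (w ⊖ v) t (v ⊖ w) t′ ⟩
      ((w ⊖ v) ⊕ (v ⊖ w)) ⊕ (t ⊕ t′)  ≡⟨ cong₂ _⊕_ (⊖-anticomm w v) t⊕t′≡0 ⟩
      𝟘 n ⊕ 𝟘 n                       ≡⟨ ⊕-identityʳ (𝟘 n) ⟩
      𝟘 n                             ∎
      where open ≡-Reasoning

    φ-split : ∀ a {r} → (L₁ ∩ L₂) r → φ (r ⊕ a ⊙ v) ≡ (r ⊕ a ⊙ t) ⊕ a ⊙ w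
    φ-split a {r} r∈R = trans (cong (λ c → (r ⊕ a ⊙ v) ⊕ c ⊙ u) (S₁.coefficient-split a r∈R))
                              (rearrange r v w t)
      where
      rearrange : ∀ {k} (r v w t : Vec K k) → (r ⊕ a ⊙ v) ⊕ a ⊙ ((w ⊖ v) ⊕ t) ≡ (r ⊕ a ⊙ t) ⊕ a ⊙ w
      rearrange []       []       []       []       = refl
      rearrange (r ∷ rs) (v ∷ vs) (w ∷ ws) (t ∷ ts) = cong₂ _∷_ (begin
        (r + a * v) + a * ((w + - 1# * v) + t)
          ≡⟨ solve 6 (λ r a v w m t → (r :+ a :* v) :+ a :* ((w :+ m :* v) :+ t)
                                      := ((r :+ a :* t) :+ a :* w) :+ (a :* v) :* (con 1 :+ m)) refl
               r a v w (- 1#) t ⟩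
        ((r + a * t) + a * w) + (a * v) * (1# + - 1#)
          ≡⟨ cong (λ c → ((r + a * t) + a * w) + (a * v) * c) (-‿inverseʳ 1#) ⟩
        ((r + a * t) + a * w) + (a * v) * 0#
          ≡⟨ trans (cong (_ +_) (zeroʳ _)) (+-identityʳ _) ⟩
        (r + a * t) + a * w ∎) (rearrange rs vs ws ts)
        where open ≡-Reasoning

    private
      ⊕⊙t∈ : ∀ {L} → IsSubspace L → L t → ∀ a {r} → L r → L (r ⊕ a ⊙ t)
      ⊕⊙t∈ L-sub t∈L a r∈L = ⊕∈ L-sub r∈L (⊙∈ L-sub a t∈L)

    φ-∈L₂ : ∀ {y} → L₁ y → L₂ (φ y)
    φ-∈L₂ {y} y∈L₁ with S₁.split y y∈L₁
    ... | a , r , r∈R , refl = subst L₂ (sym (φ-split a r∈R))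
      (⊕∈ L₂-sub (⊕⊙t∈ L₂-sub (proj₂ t∈R) a (proj₂ r∈R)) (⊙∈ L₂-sub a S₂.v∈L))

    φ-∉L₁ : ∀ {y} → (L₁ ∖ L₂) y → ¬ L₁ (φ y)
    φ-∉L₁ {y} (y∈L₁ , y∉L₂) with S₁.split y y∈L₁
    ... | a , r , r∈R , refl = λ φy∈L₁ → S₂.v∉L′ (∈-unscale L₁-sub (S₁.split-coefficient≢0 (proj₂ r∈R) y∉L₂)
      (∈-cancelˡ L₁-sub (⊕⊙t∈ L₁-sub (proj₁ t∈R) a (proj₁ r∈R)) (subst L₁ (φ-split a r∈R) φy∈L₁)))

    φ′∘φ : ∀ {y} → L₁ y → φ′ (φ y) ≡ y
    φ′∘φ {y} y∈L₁ with S₁.split y y∈L₁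
    ... | a , r , r∈R , refl = begin
      φ y ⊕ S₂.coefficient (φ y) ⊙ u′  ≡⟨ cong (λ c → φ y ⊕ c ⊙ u′) (trans (cong S₂.coefficient (φ-split a r∈R))
                                            (S₂.coefficient-split a r+at∈R)) ⟩
      φ y ⊕ a ⊙ u′                      ≡⟨ cong (λ c → (y ⊕ c ⊙ u) ⊕ a ⊙ u′) (S₁.coefficient-split a r∈R) ⟩
      (y ⊕ a ⊙ u) ⊕ a ⊙ u′              ≡⟨ ⊕-assoc y (a ⊙ u) (a ⊙ u′) ⟩
      y ⊕ (a ⊙ u ⊕ a ⊙ u′)              ≡⟨ cong (y ⊕_) (sym (⊙-distribˡ a u u′)) ⟩
      y ⊕ a ⊙ (u ⊕ u′)                  ≡⟨ cong (λ s → y ⊕ a ⊙ s) u⊕u′≡0 ⟩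
      y ⊕ a ⊙ 𝟘 n                       ≡⟨ trans (cong (y ⊕_) (⊙-zeroʳ a)) (⊕-identityʳ y) ⟩
      y                                 ∎
      where
      open ≡-Reasoning
      r+at∈R : (L₂ ∩ L₁) (r ⊕ a ⊙ t)
      r+at∈R = ⊕⊙t∈ L₂-sub (proj₂ t∈R) a (proj₂ r∈R) , ⊕⊙t∈ L₁-sub (proj₁ t∈R) a (proj₁ r∈R)

    φ′-⊙ : ∀ c z → φ′ (c ⊙ z) ≡ c ⊙ φ′ z
    φ′-⊙ c z = begin
      c ⊙ z ⊕ S₂.coefficient (c ⊙ z) ⊙ u′  ≡⟨ cong (λ s → c ⊙ z ⊕ s ⊙ u′)
                                                (trans (cong (_* f w w ⁻¹) (f-⊙ c z w)) (*-assoc c _ _)) ⟩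
      c ⊙ z ⊕ (c * β) ⊙ u′                 ≡⟨ cong (c ⊙ z ⊕_) (⊙-assoc c β u′) ⟩
      c ⊙ z ⊕ c ⊙ (β ⊙ u′)                 ≡⟨ sym (⊙-distribˡ c z (β ⊙ u′)) ⟩
      c ⊙ φ′ z                             ∎
      where
      open ≡-Reasoning
      β = S₂.coefficient z

    f-φ : ∀ {x} → f u x ≡ 0# → ∀ y → f (φ y) x ≡ f y x
    f-φ {x} u⊥x y = begin
      f (y ⊕ α ⊙ u) x          ≡⟨ f-+ y (α ⊙ u) x ⟩
      f y x + f (α ⊙ u) x      ≡⟨ cong (f y x +_) (f-⊙ α u x) ⟩
      f y x + α * f u x        ≡⟨ cong (λ s → f y x + α * s) u⊥x ⟩
      f y x + α * 0#           ≡⟨ trans (cong (f y x +_) (zeroʳ α)) (+-identityʳ _) ⟩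
      f y x                    ∎
      where
      open ≡-Reasoning
      α = S₁.coefficient y

    toC₂ : V → V
    toC₂ y = normalise (φ y)

    private
      φ≢0 : ∀ {y} → (L₁ ∖ L₂) y → φ y ≢ 𝟘 n
      φ≢0 y∈L₁∖L₂ φy≡0 = φ-∉L₁ y∈L₁∖L₂ (subst L₁ (sym φy≡0) (0∈ L₁-sub))

      scale≢0 : ∀ {y} → (L₁ ∖ L₂) y → leading (φ y) ⁻¹ ≢ 0#
      scale≢0 y∈L₁∖L₂ = ⁻¹-≢0 (leading-≢0 _ (φ≢0 y∈L₁∖L₂))

    toC₂-∈ : ∀ {y} → C₁ y → C₂ (toC₂ y)
    toC₂-∈ {y} (_ , y∈L₁∖L₂@(y∈L₁ , _)) =
      (normalise-Normalised (φ y) (φ≢0 y∈L₁∖L₂) , S₂.coclique z∈L₂∖L₁ z∈L₂∖L₁) , z∈L₂∖L₁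
      where
      z∈L₂∖L₁ : (L₂ ∖ L₁) (toC₂ y)
      z∈L₂∖L₁ = ⊙∈ L₂-sub _ (φ-∈L₂ y∈L₁) , φ-∉L₁ y∈L₁∖L₂ ∘ ∈-unscale L₁-sub (scale≢0 y∈L₁∖L₂)

    normalise-φ′-toC₂ : ∀ {y} → C₁ y → normalise (φ′ (toC₂ y)) ≡ y
    normalise-φ′-toC₂ {y} ((y-normalised , _) , y∈L₁∖L₂@(y∈L₁ , _)) = begin
      normalise (φ′ (c ⊙ φ y))  ≡⟨ cong normalise (φ′-⊙ c (φ y)) ⟩
      normalise (c ⊙ φ′ (φ y))  ≡⟨ cong (λ s → normalise (c ⊙ s)) (φ′∘φ y∈L₁) ⟩
      normalise (c ⊙ y)         ≡⟨ normalise-⊙ y y-normalised (scale≢0 y∈L₁∖L₂) ⟩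
      y                         ∎
      where
      open ≡-Reasoning
      c = leading (φ y) ⁻¹

    toC₂-⊥ : ∀ {x y} → f u x ≡ 0# → f y x ≡ 0# → f (toC₂ y) x ≡ 0#
    toC₂-⊥ {x} {y} u⊥x y⊥x =
      trans (f-⊙ c (φ y) x) (trans (cong (c *_) (trans (f-φ u⊥x y) y⊥x)) (zeroʳ c))
      where c = leading (φ y) ⁻¹

  module Switching (P : Pencil) (L₁? : Decidable (Pencil.L₁ P)) (L₂? : Decidable (Pencil.L₂ P))
                   {k : ℕ} (radical-dim : HasDim (Pencil.L₁ P ∩ Pencil.L₂ P) k) where
    open Pencil P
    private
      R = L₁ ∩ L₂

    C₁? : Decidable C₁
    C₁? y = (Normalised? y ×-dec ¬? (f y y ≟ 0#)) ×-dec L₁? y ×-dec ¬? (L₂? y)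

    ≅⇒equal-sizes : ∀ {Q Q′ : V → Set} → Decidable Q → Q ≅ Q′ → ∃[ s ] (Q HasSize s × Q′ HasSize s)
    ≅⇒equal-sizes Q? Q≅Q′ =
      let s , size = Decidable-HasSize (allVec n) ∈-allVec (allVec-Unique n) Q? in
      s , size , HasSize-≅ Q≅Q′ size

    module _ (t t′ : V) (t∈R : R t) (t′∈R : R t′) (t⊕t′≡0 : t ⊕ t′ ≡ 𝟘 n) where
      private
        module T  = Transfer P t t′ t∈R t⊕t′≡0
        module T′ = Transfer (swap P) t′ t (proj₂ t′∈R , proj₁ t′∈R) (trans (⊕-comm t′ t) t⊕t′≡0)

      transfer : C₁ ≅ C₂
      transfer = record
        { to = T.toC₂ ; from = T′.toC₂ ; to-∈ = T.toC₂-∈ ; from-∈ = T′.toC₂-∈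
        ; from∘to = T.normalise-φ′-toC₂ ; to∘from = T′.normalise-φ′-toC₂ }

      ΓC₁≅ΓC₂ : ∀ {x} → f T.u x ≡ 0# → nbhdIn f x C₁ ≅ nbhdIn f x C₂
      ΓC₁≅ΓC₂ {x} u⊥x = record
        { to = T.toC₂ ; from = T′.toC₂
        ; to-∈ = λ (y⊥x , y∈C₁) → T.toC₂-⊥ u⊥x y⊥x , T.toC₂-∈ y∈C₁
        ; from-∈ = λ (z⊥x , z∈C₂) → T′.toC₂-⊥ u′⊥x z⊥x , T′.toC₂-∈ z∈C₂
        ; from∘to = T.normalise-φ′-toC₂ ∘ proj₂ ; to∘from = T′.normalise-φ′-toC₂ ∘ proj₂ }
        where
        u′⊥x : f T.u′ x ≡ 0#
        u′⊥x = begin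
          f T.u′ x                ≡⟨ sym (+-identityˡ _) ⟩
          0# + f T.u′ x           ≡⟨ cong (_+ f T.u′ x) (sym u⊥x) ⟩
          f T.u x + f T.u′ x      ≡⟨ sym (f-+ T.u T.u′ x) ⟩
          f (T.u ⊕ T.u′) x        ≡⟨ cong (λ s → f s x) T.u⊕u′≡0 ⟩
          f (𝟘 n) x               ≡⟨ f-𝟘ˡ x ⟩
          0#                      ∎
          where open ≡-Reasoning

    C₁∪C₂ : V → Set
    C₁∪C₂ = _∪_ f C₁ C₂

    C₁≅C₂ : C₁ ≅ C₂
    C₁≅C₂ = transfer (𝟘 n) (𝟘 n) 𝟘∈R 𝟘∈R (⊕-identityʳ (𝟘 n))
      where
      𝟘∈R : R (𝟘 n)
      𝟘∈R = 0∈ L₁-sub , 0∈ L₂-sub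

    C₁-coclique : ∀ x → C₁ x → nbhdIn f x C₁ HasSize 0
    C₁-coclique x (_ , x∈L₁∖L₂) = empty-HasSize-0 λ y (y⊥x , _ , y∈L₁∖L₂) → S₁.coclique x∈L₁∖L₂ y∈L₁∖L₂ y⊥x

    C₂-coclique : ∀ x → C₂ x → nbhdIn f x C₂ HasSize 0
    C₂-coclique x (_ , x∈L₂∖L₁) = empty-HasSize-0 λ y (y⊥x , _ , y∈L₂∖L₁) → S₂.coclique x∈L₂∖L₁ y∈L₂∖L₁ y⊥x

    -- Both points are orthogonal to the radical, so S₁ and S₂ reduce adjacency to that of v and w.
    C₁-C₂-adjacent⇔ : ∀ {y z} → C₁ y → C₂ z → f z y ≡ 0# ⇔ f v w ≡ 0#
    C₁-C₂-adjacent⇔ {y} {z} (_ , y∈L₁∖L₂@(y∈L₁ , _)) (_ , z∈L₂∖L₁) = mk⇔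
      (Equivalence.to (S₁.⊥⇔v⊥ w⊥R y∈L₁∖L₂) ∘ orthogonal-sym w y ∘ Equivalence.to (S₂.⊥⇔v⊥ y⊥R z∈L₂∖L₁))
      (Equivalence.from (S₂.⊥⇔v⊥ y⊥R z∈L₂∖L₁) ∘ orthogonal-sym y w ∘ Equivalence.from (S₁.⊥⇔v⊥ w⊥R y∈L₁∖L₂))
      where
      y⊥R : perp f (L₂ ∩ L₁) y
      y⊥R = perp-∩-comm λ _ r∈R → S₁.radical-⊥ r∈R y∈L₁
      w⊥R : perp f R w
      w⊥R = perp-∩-comm λ _ r∈R → S₂.radical-⊥ r∈R S₂.v∈L

    C₁∪C₂-regular : ∃[ s ] (∀ x → C₁∪C₂ x → nbhdIn f x C₁∪C₂ HasSize s)
    C₁∪C₂-regular with f v w ≟ 0# | ≅⇒equal-sizes C₁? C₁≅C₂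
    ... | yes v⊥w | s , C₁-size , C₂-size = s , λ
      { x (inj₁ x∈C₁) → HasSize-cong (λ y → mk⇔
          (λ y∈C₂ → Equivalence.from (C₁-C₂-adjacent⇔ x∈C₁ y∈C₂) v⊥w , inj₂ y∈C₂)
          (λ { (y⊥x , inj₁ y∈C₁) → ⊥-elim (S₁.coclique (proj₂ x∈C₁) (proj₂ y∈C₁) y⊥x)
             ; (_ , inj₂ y∈C₂) → y∈C₂ })) C₂-size
      ; x (inj₂ x∈C₂) → HasSize-cong (λ y → mk⇔
          (λ y∈C₁ → orthogonal-sym x y (Equivalence.from (C₁-C₂-adjacent⇔ y∈C₁ x∈C₂) v⊥w) , inj₁ y∈C₁)
          (λ { (_ , inj₁ y∈C₁) → y∈C₁
             ; (y⊥x , inj₂ y∈C₂) → ⊥-elim (S₂.coclique (proj₂ x∈C₂) (proj₂ y∈C₂) y⊥x) })) C₁-size }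
    ... | no v⊥̸w | _ = 0 , λ
      { x (inj₁ x∈C₁) → empty-HasSize-0 λ
          { y (y⊥x , inj₁ y∈C₁) → S₁.coclique (proj₂ x∈C₁) (proj₂ y∈C₁) y⊥x
          ; y (y⊥x , inj₂ y∈C₂) → v⊥̸w (Equivalence.to (C₁-C₂-adjacent⇔ x∈C₁ y∈C₂) y⊥x) }
      ; x (inj₂ x∈C₂) → empty-HasSize-0 λ
          { y (y⊥x , inj₁ y∈C₁) → v⊥̸w (Equivalence.to (C₁-C₂-adjacent⇔ y∈C₁ x∈C₂) (orthogonal-sym y x y⊥x))
          ; y (y⊥x , inj₂ y∈C₂) → S₂.coclique (proj₂ x∈C₂) (proj₂ y∈C₂) y⊥x } }

    private
      bs = proj₁ radical-dim
      R⇔Span = proj₂ (proj₂ radical-dim)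

    balancing : ∀ x → (Σ V λ t → R t × f w x + f t x ≡ f v x) ⊎ (perp f R x × f v x ≢ f w x)
    balancing x with perp-Span? bs x
    ... | inj₂ (i , bᵢ·x≢0) = inj₁ (c ⊙ bᵢ , (⊙∈ L₁-sub c (proj₁ bᵢ∈R) , ⊙∈ L₂-sub c (proj₂ bᵢ∈R)) , (begin
      f w x + f (c ⊙ bᵢ) x                  ≡⟨ cong (f w x +_) (f-⊙ c bᵢ x) ⟩
      f w x + (d * f bᵢ x ⁻¹) * f bᵢ x      ≡⟨ cong (f w x +_) (*-assoc d _ _) ⟩
      f w x + d * (f bᵢ x ⁻¹ * f bᵢ x)      ≡⟨ cong (λ e → f w x + d * e) (⁻¹-inverseˡ bᵢ·x≢0) ⟩
      f w x + d * 1#                        ≡⟨ cong (f w x +_) (*-identityʳ d) ⟩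
      f w x + (f v x + - 1# * f w x)        ≡⟨ solve 3 (λ a b m → a :+ (b :+ m :* a) := b :+ (a :+ m :* a)) refl
                                                 (f w x) (f v x) (- 1#) ⟩
      f v x + (f w x + - 1# * f w x)        ≡⟨ trans (cong (f v x +_) (x+-x≡0 (f w x))) (+-identityʳ _) ⟩
      f v x                                 ∎))
      where
      open ≡-Reasoning
      bᵢ = lookup bs i
      bᵢ∈R = basis-∈ radical-dim i
      d = f v x + - 1# * f w x
      c = d * f bᵢ x ⁻¹
    ... | inj₁ x⊥Span with f v x ≟ f w x
    ...   | yes v·x≡w·x = inj₁ (𝟘 n , (0∈ L₁-sub , 0∈ L₂-sub) ,
                                trans (cong (f w x +_) (f-𝟘ˡ x)) (trans (+-identityʳ _) (sym v·x≡w·x)))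
    ...   | no  v·x≢w·x = inj₂ ((λ r r∈R → x⊥Span r (Equivalence.to (R⇔Span r) r∈R)) , v·x≢w·x)

    balanced⇒u⊥x : ∀ {t x} → f w x + f t x ≡ f v x → f ((w ⊖ v) ⊕ t) x ≡ 0#
    balanced⇒u⊥x {t} {x} balanced = begin
      f ((w ⊖ v) ⊕ t) x                     ≡⟨ f-+ (w ⊖ v) t x ⟩
      f (w ⊖ v) x + f t x                   ≡⟨ cong (_+ f t x) (f-⊖ w v x) ⟩
      (f w x + - 1# * f v x) + f t x        ≡⟨ solve 4 (λ a b c m → (a :+ m :* b) :+ c := (a :+ c) :+ m :* b) refl
                                                 (f w x) (f v x) (f t x) (- 1#) ⟩
      (f w x + f t x) + - 1# * f v x        ≡⟨ cong (_+ - 1# * f v x) balanced ⟩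
      f v x + - 1# * f v x                  ≡⟨ x+-x≡0 (f v x) ⟩
      0#                                    ∎
      where open ≡-Reasoning

    outside-neighbourhood :
      ∀ x → (∃[ s ] (nbhdIn f x C₁ HasSize s × nbhdIn f x C₂ HasSize s))
            ⊎ SameSet (nbhdIn f x C₁∪C₂) C₁ ⊎ SameSet (nbhdIn f x C₁∪C₂) C₂
    outside-neighbourhood x with balancing x
    ... | inj₁ (t , t∈R , balanced) =
      inj₁ (≅⇒equal-sizes (λ y → (f y x ≟ 0#) ×-dec C₁? y)
              (ΓC₁≅ΓC₂ t ((- 1#) ⊙ t) t∈R −t∈R (⊕-inverseʳ t) (balanced⇒u⊥x balanced)))
      where −t∈R = ⊙∈ L₁-sub (- 1#) (proj₁ t∈R) , ⊙∈ L₂-sub (- 1#) (proj₂ t∈R)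
    ... | inj₂ (x⊥R , v·x≢w·x) with f v x ≟ 0# | f w x ≟ 0#
    ...   | yes v⊥x | yes w⊥x = ⊥-elim (v·x≢w·x (trans v⊥x (sym w⊥x)))
    ...   | yes v⊥x | no  w⊥̸x = inj₂ (inj₁ λ y → mk⇔
            (λ { (_ , inj₁ y∈C₁) → y∈C₁
               ; (y⊥x , inj₂ (_ , y∈L₂∖L₁)) → ⊥-elim (w⊥̸x (Equivalence.to (S₂.⊥⇔v⊥ (perp-∩-comm x⊥R) y∈L₂∖L₁) y⊥x)) })
            (λ y∈C₁ → Equivalence.from (S₁.⊥⇔v⊥ x⊥R (proj₂ y∈C₁)) v⊥x , inj₁ y∈C₁))
    ...   | no  v⊥̸x | yes w⊥x = inj₂ (inj₂ λ y → mk⇔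
            (λ { (y⊥x , inj₁ (_ , y∈L₁∖L₂)) → ⊥-elim (v⊥̸x (Equivalence.to (S₁.⊥⇔v⊥ x⊥R y∈L₁∖L₂) y⊥x))
               ; (_ , inj₂ y∈C₂) → y∈C₂ })
            (λ y∈C₂ → Equivalence.from (S₂.⊥⇔v⊥ (perp-∩-comm x⊥R) (proj₂ y∈C₂)) w⊥x , inj₂ y∈C₂))
    ...   | no  v⊥̸x | no  w⊥̸x = inj₁ (0 ,
            empty-HasSize-0 (λ y (y⊥x , _ , y∈L₁∖L₂) → v⊥̸x (Equivalence.to (S₁.⊥⇔v⊥ x⊥R y∈L₁∖L₂) y⊥x)) ,
            empty-HasSize-0 (λ y (y⊥x , _ , y∈L₂∖L₁) → w⊥̸x (Equivalence.to (S₂.⊥⇔v⊥ (perp-∩-comm x⊥R) y∈L₂∖L₁) y⊥x)))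

    isSwitchingSet : IsSwitchingSet f C₁ C₂
    isSwitchingSet = (λ _ → proj₁) , (λ _ → proj₁) , (λ _ (_ , _ , y∉L₂) (_ , y∈L₂ , _) → y∉L₂ y∈L₂) ,
                     ≅⇒equal-sizes C₁? C₁≅C₂ , (0 , C₁-coclique , C₂-coclique) , C₁∪C₂-regular ,
                     (λ x _ _ _ → outside-neighbourhood x)

  radical-pencil-IsSwitchingSet :
    ∀ {k L₁ L₂} → IsSubspace L₁ → IsSubspace L₂ → HasDim L₁ (suc k) → HasDim L₂ (suc k) → HasDim (L₁ ∩ L₂) k →
    SameSet (L₁ ∩ L₂) (L₁ ∩ perp f L₁) → SameSet (L₁ ∩ L₂) (L₂ ∩ perp f L₂) →
    IsSwitchingSet f (λ x → Vertex f x × L₁ x × ¬ L₂ x) (λ x → Vertex f x × L₂ x × ¬ L₁ x)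
  radical-pencil-IsSwitchingSet {L₁ = L₁} {L₂} L₁-sub L₂-sub dim₁ dim₂ dim∩ radical₁ radical₂ =
    Switching.isSwitchingSet pencil (HasDim⇒Decidable dim₁) (HasDim⇒Decidable dim₂) dim∩
    where
    pencil : Pencil
    pencil = record
      { L₁ = L₁ ; L₂ = L₂ ; L₁-sub = L₁-sub ; L₂-sub = L₂-sub
      ; splitting₁ = splitting L₁-sub L₂-sub dim₁ dim∩
      ; splitting₂ = splitting L₂-sub L₁-sub dim₂ (HasDim-cong (∩-comm L₁ L₂) dim∩)
      ; radical₁ = radical₁
      ; radical₂ = λ x → ⇔-trans (∩-comm L₂ L₁ x) (radical₂ x) }

theorem7 : {q : ℕ} (F : FiniteField q) (n : ℕ) →
    let open Geometry F n in
    (f : V → V → K) → PolarityForm f →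
    (d : ℕ) → 3 ≤ d → HasRank f d →
    (m : ℕ) → 3 ≤ m → m ≤ d →
    (L₁ L₂ : Subspace) →
    IsSubspace L₁ → IsSubspace L₂ →
    HasDim L₁ (m ∸ 1) → HasDim L₂ (m ∸ 1) →
    ¬ TotallyIsotropic f L₁ → ¬ TotallyIsotropic f L₂ →
    HasDim (L₁ ∩ L₂) (m ∸ 2) →
    SameSet (L₁ ∩ L₂) (L₁ ∩ perp f L₁) →
    SameSet (L₁ ∩ L₂) (L₂ ∩ perp f L₂) →
    IsSwitchingSet f
      (λ x → Vertex f x × L₁ x × ¬ L₂ x)
      (λ x → Vertex f x × L₂ x × ¬ L₁ x)
theorem7 F n f form _ _ _ (suc (suc (suc k))) (s≤s (s≤s (s≤s _))) _ L₁ L₂ L₁-sub L₂-sub dim₁ dim₂ _ _ dim∩ radical₁ radical₂ =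
  PolarGeometry.radical-pencil-IsSwitchingSet F n (Forms.PolarityForm⇒ReflexiveForm F n form)
    L₁-sub L₂-sub dim₁ dim₂ dim∩ radical₁ radical₂
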